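{- Let $R_1=\{(a,b): a,b\in\{0,1,2\}\}$ and $R_2=\{(a,b): a,b\in\{1,2,3\}\}$. Then the mesh patterns $(123,R_1)$ and $(321,R_1)$ are jointly equidistributed, and the mesh patterns $(123,R_2)$ and $(321,R_2)$ are jointly equidistributed.
   Context: $S_n$ is the set of permutations of $\{1,\dots,n\}$. A mesh pattern of length $k$ is a pair $(\tau,R)$ with $\tau\in S_k$ and $R\subseteq\{0,\dots,k\}^2$; the element $(a,b)\in R$ is the "shaded box" whose corners are $(a,b),(a,b+1),(a+1,b+1),(a+1,b)$ in the plot of $\tau$ (first coordinate = position, second = value). An occurrence of $(\tau,R)$ in $\pi=\pi_1\cdots\pi_n\in S_n$ is a tuple of indices $i_1<\dots<i_k$ such that $\pi_{i_1}\cdots\pi_{i_k}$ is order-isomorphic to $\tau$ and, setting $i_0=0$, $i_{k+1}=n+1$, letting $v_1<\dots<v_k$ be the values $\pi_{i_1},\dots,\pi_{i_k}$ in increasing order and $v_0=0$, $v_{k+1}=n+1$, for every $(a,b)\in R$ there is no index $m$ with $i_a<m<i_{a+1}$ and $v_b<\pi_m<v_{b+1}$. The number of occurrences is the number of such index tuples. Two mesh patterns $q_1,q_2$ are jointly equidistributed if for all $n\ge 1$ and all integers $k,\ell\ge 0$, the number of $\pi\in S_n$ with exactly $k$ occurrences of $q_1$ and exactly $\ell$ occurrences of $q_2$ equals the number of $\pi\in S_n$ with exactly $\ell$ occurrences of $q_1$ and exactly $k$ occurrences of $q_2$. -}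

module Defs where

open import Data.Bool using (Bool; true; false; _∧_; _∨_; not; if_then_else_)
open import Data.Nat using (ℕ; zero; suc; _+_; _<ᵇ_; _≡ᵇ_)
open import Data.Nat.Properties using (≤-decTotalOrder)
open import Data.List using (List; []; _∷_; _++_; [_]; map; filter; length; concatMap; upTo)
open import Data.Product using (_×_; _,_)
open import Data.List.Sort.InsertionSort ≤-decTotalOrder using (sort)

-- Conventions: a permutation π ∈ S_n is the word π₁ ⋯ πₙ, stored as a list of
-- naturals of length n which contains each of 1,…,n exactly once.
-- Positions are 1-based: position m of π is (nth π m).

-- 1-based lookup with default 0
nth : List ℕ → ℕ → ℕ
nth []       _             = 0
nth (x ∷ xs) zero          = 0
nth (x ∷ xs) (suc zero)    = x
nth (x ∷ xs) (suc (suc m)) = nth xs (suc m)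

range1 : ℕ → List ℕ
range1 n = map suc (upTo n)

words : ℕ → ℕ → List (List ℕ)
words zero    n = [] ∷ []
words (suc m) n = concatMap (λ x → map (x ∷_) (words m n)) (range1 n)

allB : {A : Set} → (A → Bool) → List A → Bool
allB p []       = true
allB p (x ∷ xs) = p x ∧ allB p xs

anyB : {A : Set} → (A → Bool) → List A → Bool
anyB p []       = false
anyB p (x ∷ xs) = p x ∨ anyB p xs

boolFilter : {A : Set} → (A → Bool) → List A → List A
boolFilter p []       = []
boolFilter p (x ∷ xs) = if p x then x ∷ boolFilter p xs else boolFilter p xs

countB : (ℕ → Bool) → List ℕ → ℕ
countB p xs = length (boolFilter p xs)

isPerm : ℕ → List ℕ → Bool
isPerm n π = (length π ≡ᵇ n) ∧ allB (λ j → countB (λ x → x ≡ᵇ j) π ≡ᵇ 1) (range1 n)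

Sym : ℕ → List (List ℕ)
Sym n = boolFilter (isPerm n) (words n n)

record MeshPattern : Set where
  constructor mesh
  field
    τ : List ℕ
    R : List (ℕ × ℕ)
open MeshPattern public

strictlyIncreasing : List ℕ → Bool
strictlyIncreasing []           = true
strictlyIncreasing (x ∷ [])     = true
strictlyIncreasing (x ∷ y ∷ xs) = (x <ᵇ y) ∧ strictlyIncreasing (y ∷ xs)

indexTuples : ℕ → ℕ → List (List ℕ)
indexTuples k n = boolFilter strictlyIncreasing (words k n)

iff : Bool → Bool → Bool
iff true  b = b
iff false b = not b

orderIso : List ℕ → List ℕ → List ℕ → Bool
orderIso τ π is =
  (length is ≡ᵇ length τ) ∧
  allB (λ a → allB (λ b → iff (nth π (nth is a) <ᵇ nth π (nth is b)) (nth τ a <ᵇ nth τ b))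
                 (range1 (length τ)))
      (range1 (length τ))

-- the box (a,b) is empty, where I = i₀ i₁ … i_{k+1} and V = v₀ v₁ … v_{k+1}
-- are the extended index and sorted-value sequences (0-based lookup via nth ∘ suc)
boxEmpty : List ℕ → List ℕ → List ℕ → ℕ × ℕ → Bool
boxEmpty π I V (a , b) =
  not (anyB (λ m → (nth I (suc a) <ᵇ m) ∧ (m <ᵇ nth I (suc (suc a))) ∧
                  (nth V (suc b) <ᵇ nth π m) ∧ (nth π m <ᵇ nth V (suc (suc b))))
           (range1 (length π)))

isOccurrence : MeshPattern → List ℕ → List ℕ → Bool
isOccurrence p π is =
  orderIso (τ p) π is ∧ allB (boxEmpty π I V) (R p)
  where
    n = length π
    I = 0 ∷ is ++ [ suc n ]
    V = 0 ∷ sort (map (nth π) is) ++ [ suc n ]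

occ : MeshPattern → List ℕ → ℕ
occ p π = length (boolFilter (isOccurrence p π) (indexTuples (length (τ p)) (length π)))

jointCount : MeshPattern → MeshPattern → ℕ → ℕ → ℕ → ℕ
jointCount p₁ p₂ n k ℓ =
  length (boolFilter (λ π → (occ p₁ π ≡ᵇ k) ∧ (occ p₂ π ≡ᵇ ℓ)) (Sym n))

open import Relation.Binary.PropositionalEquality using (_≡_)
open import Data.Nat using (_≤_)

JointlyEquidistributed : MeshPattern → MeshPattern → Set
JointlyEquidistributed p₁ p₂ =
  ∀ (n : ℕ) → 1 ≤ n → ∀ (k ℓ : ℕ) → jointCount p₁ p₂ n k ℓ ≡ jointCount p₁ p₂ n ℓ k

square : List ℕ → List (ℕ × ℕ)
square S = concatMap (λ a → map (a ,_) S) S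

R₁ : List (ℕ × ℕ)
R₁ = square (0 ∷ 1 ∷ 2 ∷ [])

R₂ : List (ℕ × ℕ)
R₂ = square (1 ∷ 2 ∷ 3 ∷ [])

p123 p321 : List ℕ
p123 = 1 ∷ 2 ∷ 3 ∷ []
p321 = 3 ∷ 2 ∷ 1 ∷ []

-- Write π ∈ S_{n+1} as r ⊳⟨ n ⟩ σ: a first entry exceeded by exactly r later
-- entries, followed by the standardised rest σ ∈ S_n.  For R₂, the occurrences
-- of 123 or 321 avoiding the first position are those of σ, and the first
-- position starts an occurrence of 123 iff r = 2 and the two largest values of σ
-- appear in increasing order, one of 321 iff r = 0 and they appear in decreasing
-- order.  So both statistics are computed from the sequence of depths r by a
-- two-state automaton whose state is the order of the two largest values.
-- Cycling the depths 0, 1, 2, in the direction given by the state, maps this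
-- automaton to itself with its states and its two outputs exchanged; doing so at
-- every step is an involution Φ of S_n exchanging the two statistics.  Rotating
-- the plot by 180° maps (τ, R₁) to (τ, R₂) for τ ∈ {123, 321}, which gives the
-- statement for R₁.

module Submission where

open import Data.Bool using (Bool; true; false; _∧_; _∨_; not; if_then_else_)
open import Data.Bool.Properties using (T-≡; ∧-comm; ∧-zeroʳ; ∧-identityʳ; ∨-zeroʳ)
open import Data.Empty using (⊥; ⊥-elim)
open import Data.List using (List; []; _∷_; _++_; [_]; map; length; reverse; upTo; applyUpTo; _∷ʳ_; concatMap; filterᵇ)
open import Data.List.Membership.Propositional using (_∈_; _∉_)
open import Data.List.Membership.Propositional.Properties
  using (∈-map⁺; ∈-map⁻; ∈-upTo⁺; ∈-upTo⁻; ∈-∃++; ∈-filter⁻; ∈-filter⁺; ∈-concat⁺′; ∈-concat⁻′)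
open import Data.List.Properties
  using (map-++; map-∘; map-cong; map-cong-local; map-id; map-id-local; length-map; length-++; length-reverse; length-upTo;
         map-applyUpTo; applyUpTo-∷ʳ; reverse-++; unfold-reverse; reverse-map; reverse-involutive; ∷-injectiveˡ; ∷-injectiveʳ)
open import Data.List.Relation.Binary.Disjoint.Propositional using (Disjoint)
open import Data.List.Relation.Binary.Permutation.Propositional
  using (_↭_; ↭-refl; ↭-sym; ↭-trans; ↭-reflexive; prep; swap; module PermutationReasoning)
open import Data.List.Relation.Binary.Permutation.Propositional.Properties
  using (map⁺; ∈-resp-↭; drop-∷; ↭-length; ∷↭∷ʳ; ++⁺ʳ; shift; ↭-empty-inv; ↭-singleton-inv; ↭-reverse)
import Data.List.Relation.Unary.All as All
import Data.List.Relation.Unary.All.Properties as All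
import Data.List.Relation.Unary.AllPairs as AllPairs
import Data.List.Relation.Unary.AllPairs.Properties as AllPairs
open import Data.List.Relation.Unary.Any using (here; there)
open import Data.List.Relation.Unary.Unique.Propositional using (Unique)
import Data.List.Relation.Unary.Unique.Propositional.Properties as Unique
open import Data.Nat
  using (ℕ; zero; suc; pred; _+_; _*_; _∸_; _<ᵇ_; _≤ᵇ_; _≡ᵇ_; _≤_; _<_; z≤n; s≤s; _≤?_; _<?_; _≟_)
open import Data.Nat.ListAction using (sum)
open import Data.Nat.ListAction.Properties using (sum-++; sum-↭)
open import Data.Nat.Properties
open import Algebra.Properties.CommutativeSemigroup +-commutativeSemigroup using (interchange)
open import Data.List.Sort.InsertionSort.Base ≤-decTotalOrder using (insert)
open import Data.List.Sort.InsertionSort ≤-decTotalOrder using (sort)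
open import Data.Nat.Tactic.RingSolver using (solve-∀)
open import Data.Product using (_×_; _,_; proj₁; proj₂; ∃-syntax)
open import Data.Sum using (_⊎_; inj₁; inj₂)
open import Function using (_∘_; id; case_of_; Equivalence)
open import Relation.Binary.Definitions using (tri<; tri≈; tri>)
open import Relation.Binary.PropositionalEquality hiding ([_])
open import Relation.Nullary using (¬_; yes; no)
open import Relation.Nullary.Decidable using (dec-true; dec-false; T?; from-yes; _×-dec_)

open import Defs

private
  variable
    A B : Set

⟦_⟧ : Bool → ℕ
⟦ true ⟧  = 1
⟦ false ⟧ = 0

⟦⟧-∧ : ∀ a b → ⟦ a ∧ b ⟧ ≡ ⟦ a ⟧ * ⟦ b ⟧
⟦⟧-∧ true  b = sym (+-identityʳ ⟦ b ⟧)
⟦⟧-∧ false b = refl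

⟦⟧-∧³ : ∀ a b c d → ⟦ a ∧ (b ∧ (c ∧ d)) ⟧ ≡ ⟦ a ⟧ * (⟦ b ⟧ * (⟦ c ⟧ * ⟦ d ⟧))
⟦⟧-∧³ a b c d = trans (⟦⟧-∧ a _) (cong (⟦ a ⟧ *_) (trans (⟦⟧-∧ b _) (cong (⟦ b ⟧ *_) (⟦⟧-∧ c d))))

⟦⟧≡ᵇ1 : ∀ b → (⟦ b ⟧ ≡ᵇ 1) ≡ b
⟦⟧≡ᵇ1 true  = refl
⟦⟧≡ᵇ1 false = refl

module _ {m n : ℕ} where

  <ᵇ-true : m < n → (m <ᵇ n) ≡ true
  <ᵇ-true = dec-true (m <? n)

  <ᵇ-false : ¬ m < n → (m <ᵇ n) ≡ false
  <ᵇ-false = dec-false (m <? n)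

  ≡ᵇ-true : m ≡ n → (m ≡ᵇ n) ≡ true
  ≡ᵇ-true = dec-true (m ≟ n)

  ≡ᵇ-false : m ≢ n → (m ≡ᵇ n) ≡ false
  ≡ᵇ-false = dec-false (m ≟ n)

  <ᵇ-sound : (m <ᵇ n) ≡ true → m < n
  <ᵇ-sound e = <ᵇ⇒< m n (Equivalence.from T-≡ e)

  ≡ᵇ-sound : (m ≡ᵇ n) ≡ true → m ≡ n
  ≡ᵇ-sound e = ≡ᵇ⇒≡ m n (Equivalence.from T-≡ e)

<ᵇ-irrefl : ∀ m → (m <ᵇ m) ≡ false
<ᵇ-irrefl m = <ᵇ-false {m} {m} (<-irrefl refl)

≤ᵇ-true : ∀ {m n} → m ≤ n → (m ≤ᵇ n) ≡ true
≤ᵇ-true {m} {n} = dec-true (m ≤? n)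

≤ᵇ-false : ∀ {m n} → n < m → (m ≤ᵇ n) ≡ false
≤ᵇ-false {m} {n} n<m = dec-false (m ≤? n) (<⇒≱ n<m)

≤ᵇ≡not<ᵇ : ∀ a b → (a ≤ᵇ b) ≡ not (b <ᵇ a)
≤ᵇ≡not<ᵇ a b with a ≤? b
... | yes a≤b = trans (≤ᵇ-true a≤b) (cong not (sym (<ᵇ-false (≤⇒≯ a≤b))))
... | no  a≰b = trans (≤ᵇ-false (≰⇒> a≰b)) (cong not (sym (<ᵇ-true (≰⇒> a≰b))))

<ᵇ-∧-<ᵇ-suc : ∀ v y → (v <ᵇ y) ∧ (y <ᵇ suc v) ≡ false
<ᵇ-∧-<ᵇ-suc v y with v <? y
... | yes v<y rewrite <ᵇ-true v<y = <ᵇ-false (≤⇒≯ v<y)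
... | no  v≮y rewrite <ᵇ-false v≮y = refl

bool-ext : ∀ {a b} → (a ≡ true → b ≡ true) → (b ≡ true → a ≡ true) → a ≡ b
bool-ext {false} {false} _ _ = refl
bool-ext {false} {true}  _ b⇒a = b⇒a refl
bool-ext {true}  {false} a⇒b _ = sym (a⇒b refl)
bool-ext {true}  {true}  _ _ = refl

iff-true : ∀ b → iff b true ≡ b
iff-true true  = refl
iff-true false = refl

∧-true⁻ : ∀ {a b} → a ∧ b ≡ true → a ≡ true × b ≡ true
∧-true⁻ {true} {true} _ = refl , refl

∧-true⁺ : ∀ {a b} → a ≡ true → b ≡ true → a ∧ b ≡ true
∧-true⁺ refl refl = refl

false-∧ : ∀ {a b} → a ≡ false → a ∧ b ≡ false
false-∧ refl = refl

∧-cong-if : ∀ a {b c} → (a ≡ true → b ≡ c) → a ∧ b ≡ a ∧ c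
∧-cong-if true  eq = eq refl
∧-cong-if false _  = refl

∧-absorb : ∀ {a} c → (c ≡ true → a ≡ true) → a ∧ c ≡ c
∧-absorb {a} false _   = ∧-zeroʳ a
∧-absorb     true  c⇒a rewrite c⇒a refl = refl

∧-left-comm : ∀ a b c → a ∧ (b ∧ c) ≡ b ∧ (a ∧ c)
∧-left-comm true  b c = refl
∧-left-comm false b c = sym (∧-zeroʳ b)

∨-left-comm : ∀ a b c → a ∨ (b ∨ c) ≡ b ∨ (a ∨ c)
∨-left-comm true  b c = sym (∨-zeroʳ b)
∨-left-comm false b c = refl

∧-reverse : ∀ a b c → a ∧ b ∧ c ≡ c ∧ b ∧ a
∧-reverse true  true  c = sym (∧-identityʳ c)
∧-reverse true  false c = sym (∧-zeroʳ c)
∧-reverse false b     c = sym (trans (cong (c ∧_) (∧-zeroʳ b)) (∧-zeroʳ c))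

∧-pair-swap : ∀ p q r s → q ∧ p ∧ s ∧ r ≡ p ∧ q ∧ r ∧ s
∧-pair-swap p q r s = trans (∧-left-comm q p (s ∧ r)) (cong (λ z → p ∧ (q ∧ z)) (∧-comm s r))

∑ : List A → (A → ℕ) → ℕ
∑ xs f = sum (map f xs)

∑-++ : ∀ (xs ys : List A) f → ∑ (xs ++ ys) f ≡ ∑ xs f + ∑ ys f
∑-++ xs ys f = trans (cong sum (map-++ f xs ys)) (sum-++ (map f xs) (map f ys))

∑-map : ∀ (g : A → B) xs f → ∑ (map g xs) f ≡ ∑ xs (f ∘ g)
∑-map g xs f = cong sum (sym (map-∘ xs))

∑-cong : ∀ (xs : List A) {f g} → (∀ {x} → x ∈ xs → f x ≡ g x) → ∑ xs f ≡ ∑ xs g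
∑-cong []       eq = refl
∑-cong (x ∷ xs) eq = cong₂ _+_ (eq (here refl)) (∑-cong xs (eq ∘ there))

∑-↭ : ∀ {xs ys : List A} f → xs ↭ ys → ∑ xs f ≡ ∑ ys f
∑-↭ f p = sum-↭ (map⁺ f p)

∑-*ˡ : ∀ (xs : List A) c f → ∑ xs (λ x → c * f x) ≡ c * ∑ xs f
∑-*ˡ []       c f = sym (*-zeroʳ c)
∑-*ˡ (x ∷ xs) c f = trans (cong (c * f x +_) (∑-*ˡ xs c f)) (sym (*-distribˡ-+ c (f x) (∑ xs f)))

∑-zero : ∀ (xs : List A) {f} → (∀ {x} → x ∈ xs → f x ≡ 0) → ∑ xs f ≡ 0
∑-zero []       eq = refl
∑-zero (x ∷ xs) eq = cong₂ _+_ (eq (here refl)) (∑-zero xs (eq ∘ there))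

∑-concatMap : ∀ (g : A → List B) xs f → ∑ (concatMap g xs) f ≡ ∑ xs (λ x → ∑ (g x) f)
∑-concatMap g []       f = refl
∑-concatMap g (x ∷ xs) f = trans (∑-++ (g x) (concatMap g xs) f) (cong (∑ (g x) f +_) (∑-concatMap g xs f))

∑-+ : ∀ (xs : List A) f g → ∑ xs (λ x → f x + g x) ≡ ∑ xs f + ∑ xs g
∑-+ []       f g = refl
∑-+ (x ∷ xs) f g = trans (cong (f x + g x +_) (∑-+ xs f g)) (interchange (f x) (g x) (∑ xs f) (∑ xs g))

∑-comm : ∀ (xs : List A) (ys : List B) (f : A → B → ℕ) →
         ∑ xs (λ x → ∑ ys (f x)) ≡ ∑ ys (λ y → ∑ xs (λ x → f x y))
∑-comm []       ys f = sym (∑-zero ys (λ _ → refl))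
∑-comm (x ∷ xs) ys f = trans (cong (∑ ys (f x) +_) (∑-comm xs ys f)) (sym (∑-+ ys (f x) (λ y → ∑ xs (λ x′ → f x′ y))))

∑³ : List ℕ → (ℕ → ℕ → ℕ → ℕ) → ℕ
∑³ S F = ∑ S λ i → ∑ S λ j → ∑ S λ k → F i j k

∑³-reverse : ∀ S F → ∑³ S F ≡ ∑³ S (λ i j k → F k j i)
∑³-reverse S F = begin
  ∑ S (λ i → ∑ S λ j → ∑ S λ k → F i j k)  ≡⟨ ∑-cong S (λ {i} _ → ∑-comm S S (F i)) ⟩
  ∑ S (λ i → ∑ S λ k → ∑ S λ j → F i j k)  ≡⟨ ∑-comm S S _ ⟩
  ∑ S (λ k → ∑ S λ i → ∑ S λ j → F i j k)  ≡⟨ ∑-cong S (λ {k} _ → ∑-comm S S (λ i j → F i j k)) ⟩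
  ∑ S (λ k → ∑ S λ j → ∑ S λ i → F i j k)  ∎
  where open ≡-Reasoning

allB-true⁻ : ∀ {p : A → Bool} {x xs} → allB p xs ≡ true → x ∈ xs → p x ≡ true
allB-true⁻ {p = p} {xs = y ∷ _} all (here refl) = proj₁ (∧-true⁻ {p y} all)
allB-true⁻ {p = p} {xs = y ∷ _} all (there x∈) = allB-true⁻ (proj₂ (∧-true⁻ {p y} all)) x∈

allB-true⁺ : ∀ {p : A → Bool} xs → (∀ {x} → x ∈ xs → p x ≡ true) → allB p xs ≡ true
allB-true⁺ []       _   = refl
allB-true⁺ (x ∷ xs) all = ∧-true⁺ (all (here refl)) (allB-true⁺ xs (all ∘ there))

allB-false : ∀ {p : A → Bool} {x xs} → x ∈ xs → p x ≡ false → allB p xs ≡ false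
allB-false {p = p} {xs = y ∷ _} (here refl) px rewrite px = refl
allB-false {p = p} {xs = y ∷ _} (there x∈) px = trans (cong (p y ∧_) (allB-false x∈ px)) (∧-zeroʳ (p y))

allB-cong : ∀ {p q : A → Bool} xs → (∀ {x} → x ∈ xs → p x ≡ q x) → allB p xs ≡ allB q xs
allB-cong []       eq = refl
allB-cong (x ∷ xs) eq = cong₂ _∧_ (eq (here refl)) (allB-cong xs (eq ∘ there))

allB-map : ∀ (p : B → Bool) (f : A → B) xs → allB p (map f xs) ≡ allB (p ∘ f) xs
allB-map p f []       = refl
allB-map p f (x ∷ xs) = cong (p (f x) ∧_) (allB-map p f xs)

allB-↭ : ∀ (p : A → Bool) {xs ys} → xs ↭ ys → allB p xs ≡ allB p ys
allB-↭ p _↭_.refl            = refl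
allB-↭ p (prep x xs↭ys)      = cong (p x ∧_) (allB-↭ p xs↭ys)
allB-↭ p (swap x y xs↭ys)    = trans (cong (λ b → p x ∧ (p y ∧ b)) (allB-↭ p xs↭ys)) (∧-left-comm (p x) (p y) _)
allB-↭ p (_↭_.trans ↭₁ ↭₂)  = trans (allB-↭ p ↭₁) (allB-↭ p ↭₂)

anyB-true : ∀ {p : A → Bool} {x xs} → x ∈ xs → p x ≡ true → anyB p xs ≡ true
anyB-true {p = p} {xs = y ∷ _} (here refl) px rewrite px = refl
anyB-true {p = p} {xs = y ∷ _} (there x∈) px = trans (cong (p y ∨_) (anyB-true x∈ px)) (∨-zeroʳ (p y))

anyB-false : ∀ {p : A → Bool} xs → (∀ {x} → x ∈ xs → p x ≡ false) → anyB p xs ≡ false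
anyB-false []       _    = refl
anyB-false (x ∷ xs) none = cong₂ _∨_ (none (here refl)) (anyB-false xs (none ∘ there))

anyB-cong : ∀ {p q : A → Bool} xs → (∀ {x} → x ∈ xs → p x ≡ q x) → anyB p xs ≡ anyB q xs
anyB-cong []       eq = refl
anyB-cong (x ∷ xs) eq = cong₂ _∨_ (eq (here refl)) (anyB-cong xs (eq ∘ there))

anyB-map : ∀ (p : B → Bool) (f : A → B) xs → anyB p (map f xs) ≡ anyB (p ∘ f) xs
anyB-map p f []       = refl
anyB-map p f (x ∷ xs) = cong (p (f x) ∨_) (anyB-map p f xs)

anyB-↭ : ∀ (p : A → Bool) {xs ys} → xs ↭ ys → anyB p xs ≡ anyB p ys
anyB-↭ p _↭_.refl            = refl
anyB-↭ p (prep x xs↭ys)      = cong (p x ∨_) (anyB-↭ p xs↭ys)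
anyB-↭ p (swap x y xs↭ys)    = trans (cong (λ b → p x ∨ (p y ∨ b)) (anyB-↭ p xs↭ys)) (∨-left-comm (p x) (p y) _)
anyB-↭ p (_↭_.trans ↭₁ ↭₂)  = trans (anyB-↭ p ↭₁) (anyB-↭ p ↭₂)

boolFilter≡filterᵇ : ∀ (p : A → Bool) xs → boolFilter p xs ≡ filterᵇ p xs
boolFilter≡filterᵇ p []       = refl
boolFilter≡filterᵇ p (x ∷ xs) with p x
... | true  = cong (x ∷_) (boolFilter≡filterᵇ p xs)
... | false = boolFilter≡filterᵇ p xs

∈-boolFilter⁻ : ∀ {p : A → Bool} {x} xs → x ∈ boolFilter p xs → x ∈ xs × p x ≡ true
∈-boolFilter⁻ {p = p} xs x∈ with ∈-filter⁻ (T? ∘ p) (subst (_ ∈_) (boolFilter≡filterᵇ p xs) x∈)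
... | x∈xs , px = x∈xs , Equivalence.to T-≡ px

∈-boolFilter⁺ : ∀ {p : A → Bool} {x xs} → x ∈ xs → p x ≡ true → x ∈ boolFilter p xs
∈-boolFilter⁺ {p = p} {xs = xs} x∈ px =
  subst (_ ∈_) (sym (boolFilter≡filterᵇ p xs)) (∈-filter⁺ (T? ∘ p) x∈ (Equivalence.from T-≡ px))

unique-boolFilter : ∀ (p : A → Bool) {xs} → Unique xs → Unique (boolFilter p xs)
unique-boolFilter p {xs} u = subst Unique (sym (boolFilter≡filterᵇ p xs)) (Unique.filter⁺ (T? ∘ p) u)

length-boolFilter : ∀ p (xs : List A) → length (boolFilter p xs) ≡ ∑ xs (⟦_⟧ ∘ p)
length-boolFilter p []       = refl
length-boolFilter p (x ∷ xs) with p x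
... | true  = cong suc (length-boolFilter p xs)
... | false = length-boolFilter p xs

length-boolFilter-∧ : ∀ (p q : A → Bool) xs → length (boolFilter q (boolFilter p xs)) ≡ ∑ xs (λ x → ⟦ p x ∧ q x ⟧)
length-boolFilter-∧ p q []       = refl
length-boolFilter-∧ p q (x ∷ xs) with p x
... | false = length-boolFilter-∧ p q xs
... | true with q x
...   | true  = cong suc (length-boolFilter-∧ p q xs)
...   | false = length-boolFilter-∧ p q xs

unique-⊆⇒length≤ : ∀ {xs ys : List A} → Unique xs → (∀ {x} → x ∈ xs → x ∈ ys) → length xs ≤ length ys
unique-⊆⇒length≤ {xs = []}     _              _   = z≤n
unique-⊆⇒length≤ {xs = x ∷ xs} (x∉xs AllPairs.∷ u) ⊆ys with ∈-∃++ (⊆ys (here refl))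
... | as , bs , refl = ≤-trans (s≤s (unique-⊆⇒length≤ u ⊆as++bs)) (≤-reflexive (sym (↭-length (shift x as bs))))
  where
  ⊆as++bs : ∀ {z} → z ∈ xs → z ∈ as ++ bs
  ⊆as++bs z∈ with ∈-resp-↭ (shift x as bs) (⊆ys (there z∈))
  ... | here z≡x = ⊥-elim (All.lookup x∉xs z∈ (sym z≡x))
  ... | there z∈′ = z∈′

unique-map : ∀ {f : A → B} {xs} → (∀ {x y} → x ∈ xs → y ∈ xs → f x ≡ f y → x ≡ y) → Unique xs → Unique (map f xs)
unique-map inj AllPairs.[] = AllPairs.[]
unique-map {f = f} inj (x∉xs AllPairs.∷ u) =
  All.map⁺ (All.tabulate (λ y∈ fx≡fy → All.lookup x∉xs y∈ (inj (here refl) (there y∈) fx≡fy)))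
  AllPairs.∷ unique-map (λ x∈ y∈ → inj (there x∈) (there y∈)) u

length-boolFilter-≤ : ∀ (f : A → A) {p q : A → Bool} {xs} → Unique xs →
  (∀ {x} → x ∈ xs → f x ∈ xs) → (∀ {x} → x ∈ xs → f (f x) ≡ x) → (∀ {x} → x ∈ xs → p x ≡ true → q (f x) ≡ true) →
  length (boolFilter p xs) ≤ length (boolFilter q xs)
length-boolFilter-≤ f {p} {q} {xs} u f∈ ff p⇒q = begin
  length (boolFilter p xs)          ≡⟨ sym (length-map f (boolFilter p xs)) ⟩
  length (map f (boolFilter p xs))  ≤⟨ unique-⊆⇒length≤ (unique-map inj (unique-boolFilter p u)) ⊆ ⟩
  length (boolFilter q xs)          ∎
  where
  open ≤-Reasoning
  inj : ∀ {x y} → x ∈ boolFilter p xs → y ∈ boolFilter p xs → f x ≡ f y → x ≡ y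
  inj x∈ y∈ fx≡fy = trans (sym (ff (proj₁ (∈-boolFilter⁻ xs x∈))))
                          (trans (cong f fx≡fy) (ff (proj₁ (∈-boolFilter⁻ xs y∈))))
  ⊆ : ∀ {z} → z ∈ map f (boolFilter p xs) → z ∈ boolFilter q xs
  ⊆ z∈ with ∈-map⁻ f z∈
  ... | x , x∈ , refl = let x∈xs , px = ∈-boolFilter⁻ xs x∈ in ∈-boolFilter⁺ (f∈ x∈xs) (p⇒q x∈xs px)

length-boolFilter-involution : ∀ (f : A → A) {p q : A → Bool} {xs} → Unique xs →
  (∀ {x} → x ∈ xs → f x ∈ xs) → (∀ {x} → x ∈ xs → f (f x) ≡ x) → (∀ {x} → x ∈ xs → p (f x) ≡ q x) →
  length (boolFilter p xs) ≡ length (boolFilter q xs)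
length-boolFilter-involution f {p} {q} u f∈ ff pf≡q = ≤-antisym
  (length-boolFilter-≤ f u f∈ ff (λ x∈ px → trans (sym (pf≡q (f∈ x∈))) (trans (cong p (ff x∈)) px)))
  (length-boolFilter-≤ f u f∈ ff (λ x∈ qx → trans (pf≡q x∈) qx))

range1-suc : ∀ n → range1 (suc n) ≡ 1 ∷ map suc (range1 n)
range1-suc n = cong (1 ∷_) (begin
  map suc (applyUpTo suc n)  ≡⟨ map-applyUpTo suc suc n ⟩
  applyUpTo (suc ∘ suc) n    ≡⟨ sym (map-applyUpTo suc suc n) ⟩
  map suc (applyUpTo suc n)  ≡⟨ cong (map suc) (sym (map-applyUpTo id suc n)) ⟩
  map suc (range1 n)         ∎)
  where open ≡-Reasoning

range1-∷ʳ : ∀ n → range1 (suc n) ≡ range1 n ∷ʳ suc n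
range1-∷ʳ n = trans (cong (map suc) (sym (applyUpTo-∷ʳ id n))) (map-++ suc (upTo n) [ n ])

length-range1 : ∀ n → length (range1 n) ≡ n
length-range1 n = trans (length-map suc (upTo n)) (length-upTo n)

∈-range1⁻ : ∀ {m n} → m ∈ range1 n → 1 ≤ m × m ≤ n
∈-range1⁻ m∈ with ∈-map⁻ suc m∈
... | i , i∈ , refl = s≤s z≤n , ∈-upTo⁻ i∈

∈-range1⁺ : ∀ {m n} → 1 ≤ m → m ≤ n → m ∈ range1 n
∈-range1⁺ {suc i} _ m≤n = ∈-map⁺ suc (∈-upTo⁺ m≤n)

∑-range1-suc : ∀ n f → ∑ (range1 (suc n)) f ≡ f 1 + ∑ (range1 n) (f ∘ suc)
∑-range1-suc n f = trans (cong (λ xs → ∑ xs f) (range1-suc n)) (cong (f 1 +_) (∑-map suc (range1 n) f))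

unique-range1 : ∀ n → Unique (range1 n)
unique-range1 n = Unique.map⁺ suc-injective (Unique.upTo⁺ n)

positions : List ℕ → List ℕ
positions π = range1 (length π)

nth-zero : ∀ xs → nth xs 0 ≡ 0
nth-zero []      = refl
nth-zero (_ ∷ _) = refl

nth-∷ : ∀ y ρ {m} → 1 ≤ m → nth (y ∷ ρ) (suc m) ≡ nth ρ m
nth-∷ y ρ {suc m} _ = refl

nth-map : ∀ {f : ℕ → ℕ} → f 0 ≡ 0 → ∀ xs m → nth (map f xs) m ≡ f (nth xs m)
nth-map f0 []       m             = sym f0
nth-map f0 (x ∷ xs) zero          = sym f0
nth-map f0 (x ∷ xs) (suc zero)    = refl
nth-map f0 (x ∷ xs) (suc (suc m)) = nth-map f0 xs (suc m)

nth-map-inside : ∀ (f : ℕ → ℕ) xs {m} → 1 ≤ m → m ≤ length xs → nth (map f xs) m ≡ f (nth xs m)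
nth-map-inside f (x ∷ xs) {suc zero}    _ _        = refl
nth-map-inside f (x ∷ xs) {suc (suc m)} _ (s≤s m<) = nth-map-inside f xs (s≤s z≤n) m<

nth-∈ : ∀ π {m} → 1 ≤ m → m ≤ length π → nth π m ∈ π
nth-∈ (y ∷ π) {suc zero}    _ _          = here refl
nth-∈ (y ∷ π) {suc (suc m)} _ (s≤s m<) = there (nth-∈ π (s≤s z≤n) m<)

∈-nth : ∀ {y} π → y ∈ π → ∃[ m ] (1 ≤ m × m ≤ length π × nth π m ≡ y)
∈-nth (z ∷ π) (here refl) = 1 , s≤s z≤n , s≤s z≤n , refl
∈-nth (z ∷ π) (there y∈) with ∈-nth π y∈
... | suc m , _ , m≤ , nth≡ = suc (suc m) , s≤s z≤n , s≤s m≤ , nth≡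

nth-bounded : ∀ {B} L → All.All (_≤ B) L → ∀ s → nth L s ≤ B
nth-bounded []      _                         s             = z≤n
nth-bounded (x ∷ L) _                         zero          = z≤n
nth-bounded (x ∷ L) (x≤ All.∷ _)              (suc zero)    = x≤
nth-bounded (x ∷ L) (_ All.∷ L≤)              (suc (suc s)) = nth-bounded L L≤ (suc s)

nth-∷ʳ-init : ∀ xs y {m} → m ≤ length xs → nth (xs ∷ʳ y) m ≡ nth xs m
nth-∷ʳ-init []       y {zero}        _          = refl
nth-∷ʳ-init (x ∷ xs) y {zero}        _          = refl
nth-∷ʳ-init (x ∷ xs) y {suc zero}    _          = refl
nth-∷ʳ-init (x ∷ xs) y {suc (suc m)} (s≤s m<)   = nth-∷ʳ-init xs y m<

nth-∷ʳ-last : ∀ xs y → nth (xs ∷ʳ y) (suc (length xs)) ≡ y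
nth-∷ʳ-last []       y = refl
nth-∷ʳ-last (x ∷ xs) y = nth-∷ʳ-last xs y

nth-reverse : ∀ π {m} → 1 ≤ m → m ≤ length π → nth (reverse π) m ≡ nth π (suc (length π) ∸ m)
nth-reverse []      {suc m} _ ()
nth-reverse (y ∷ π) {m} 1≤m m≤ rewrite unfold-reverse y π with m≤n⇒m<n∨m≡n m≤
... | inj₁ (s≤s m≤|π|) = begin
  nth (reverse π ∷ʳ y) m                  ≡⟨ nth-∷ʳ-init (reverse π) y (subst (m ≤_) (sym (length-reverse π)) m≤|π|) ⟩
  nth (reverse π) m                       ≡⟨ nth-reverse π 1≤m m≤|π| ⟩
  nth π (suc (length π) ∸ m)              ≡⟨ sym (nth-∷ y π (m<n⇒0<n∸m (s≤s m≤|π|))) ⟩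
  nth (y ∷ π) (suc (suc (length π) ∸ m))  ≡⟨ cong (nth (y ∷ π)) (sym (+-∸-assoc 1 (m≤n⇒m≤1+n m≤|π|))) ⟩
  nth (y ∷ π) (suc (suc (length π)) ∸ m)  ∎
  where open ≡-Reasoning
... | inj₂ refl = trans (subst (λ l → nth (reverse π ∷ʳ y) (suc l) ≡ y) (length-reverse π) (nth-∷ʳ-last (reverse π) y))
                        (cong (nth (y ∷ π)) (sym (m+n∸n≡m 1 (length π))))

∑-positions : ∀ ρ (f : ℕ → ℕ) → ∑ (positions ρ) (f ∘ nth ρ) ≡ ∑ ρ f
∑-positions []      f = refl
∑-positions (y ∷ ρ) f = trans (∑-range1-suc (length ρ) (f ∘ nth (y ∷ ρ)))
  (cong (f y +_) (trans (∑-cong (positions ρ) (λ m∈ → cong f (nth-∷ y ρ (proj₁ (∈-range1⁻ m∈))))) (∑-positions ρ f)))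

Perm : ℕ → List ℕ → Set
Perm n π = π ↭ range1 n

module _ {n : ℕ} {π : List ℕ} (P : Perm n π) where

  perm-length : length π ≡ n
  perm-length = trans (↭-length P) (length-range1 n)

  perm-∈ : ∀ {y} → y ∈ π → 1 ≤ y × y ≤ n
  perm-∈ y∈ = ∈-range1⁻ (∈-resp-↭ P y∈)

  perm-∋ : ∀ {y} → 1 ≤ y → y ≤ n → y ∈ π
  perm-∋ 1≤y y≤n = ∈-resp-↭ (↭-sym P) (∈-range1⁺ 1≤y y≤n)

count : ℕ → List ℕ → ℕ
count y xs = ∑ xs (λ z → ⟦ z ≡ᵇ y ⟧)

count-absent : ∀ {y} xs → (∀ {z} → z ∈ xs → z ≢ y) → count y xs ≡ 0
count-absent xs z≢y = ∑-zero xs (λ z∈ → cong ⟦_⟧ (≡ᵇ-false (z≢y z∈)))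

count-∈ : ∀ {y xs} → y ∈ xs → 1 ≤ count y xs
count-∈ {y} (here refl) rewrite ≡ᵇ-true {y} refl = s≤s z≤n
count-∈ {y} {z ∷ xs} (there y∈) = ≤-trans (count-∈ y∈) (m≤n+m _ ⟦ z ≡ᵇ y ⟧)

count-∷≡1⇒∉ : ∀ {y} xs → count y (y ∷ xs) ≡ 1 → y ∉ xs
count-∷≡1⇒∉ {y} xs c≡1 y∈ rewrite ≡ᵇ-true {y} refl = case subst (1 ≤_) (suc-injective c≡1) (count-∈ y∈) of λ ()

count-∈⁻ : ∀ {y} xs → 1 ≤ count y xs → y ∈ xs
count-∈⁻ {y} (z ∷ xs) 1≤c with z ≟ y
... | yes refl = here refl
... | no  z≢y rewrite ≡ᵇ-false z≢y = there (count-∈⁻ xs 1≤c)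

≡ᵇ-injective : ∀ {f : ℕ → ℕ} → (∀ {a b} → f a ≡ f b → a ≡ b) → ∀ y z → (f z ≡ᵇ f y) ≡ (z ≡ᵇ y)
≡ᵇ-injective {f} inj y z with z ≟ y
... | yes refl = trans (≡ᵇ-true {f z} refl) (sym (≡ᵇ-true {z} refl))
... | no  z≢y  = trans (≡ᵇ-false (z≢y ∘ inj)) (sym (≡ᵇ-false z≢y))

count-map : ∀ {f : ℕ → ℕ} → (∀ {a b} → f a ≡ f b → a ≡ b) → ∀ y xs → count (f y) (map f xs) ≡ count y xs
count-map {f} inj y xs = trans (∑-map f xs _) (∑-cong xs (λ {z} _ → cong ⟦_⟧ (≡ᵇ-injective inj y z)))

count-range1 : ∀ {y} n → 1 ≤ y → y ≤ n → count y (range1 n) ≡ 1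
count-range1 {suc _} zero _ ()
count-range1 {y} (suc n) 1≤y y≤1+n = begin
  count y (range1 (suc n))                   ≡⟨ cong (count y) (range1-∷ʳ n) ⟩
  count y (range1 n ∷ʳ suc n)                ≡⟨ ∑-++ (range1 n) [ suc n ] _ ⟩
  count y (range1 n) + (⟦ suc n ≡ᵇ y ⟧ + 0)  ≡⟨ last (m≤n⇒m<n∨m≡n y≤1+n) ⟩
  1                                          ∎
  where
  open ≡-Reasoning
  last : y < suc n ⊎ y ≡ suc n → count y (range1 n) + (⟦ suc n ≡ᵇ y ⟧ + 0) ≡ 1
  last (inj₁ (s≤s y≤n)) rewrite count-range1 n 1≤y y≤n | ≡ᵇ-false (<⇒≢ (s≤s y≤n) ∘ sym) = refl
  last (inj₂ refl) rewrite ≡ᵇ-true {suc n} refl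
    = cong (_+ 1) (count-absent (range1 n) (λ z∈ → <⇒≢ (s≤s (proj₂ (∈-range1⁻ z∈)))))

count-perm : ∀ {n π y} → Perm n π → 1 ≤ y → y ≤ n → count y π ≡ 1
count-perm {n} P 1≤y y≤n = trans (∑-↭ _ P) (count-range1 n 1≤y y≤n)

counts⇒perm : ∀ n {π} → length π ≡ n → (∀ {j} → 1 ≤ j → j ≤ n → count j π ≡ 1) → Perm n π
counts⇒perm zero    {[]} _ _ = ↭-refl
counts⇒perm (suc n) {π} len cnt with ∈-∃++ (count-∈⁻ π (≤-reflexive (sym (cnt (s≤s z≤n) ≤-refl))))
... | as , bs , refl = begin
  as ++ [ suc n ] ++ bs  ↭⟨ shift (suc n) as bs ⟩
  suc n ∷ as ++ bs       ↭⟨ prep (suc n) (counts⇒perm n len′ cnt′) ⟩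
  suc n ∷ range1 n       ↭⟨ ∷↭∷ʳ (suc n) (range1 n) ⟩
  range1 n ∷ʳ suc n      ≡⟨ sym (range1-∷ʳ n) ⟩
  range1 (suc n)         ∎
  where
  open PermutationReasoning
  len′ : length (as ++ bs) ≡ n
  len′ = suc-injective (trans (sym (↭-length (shift (suc n) as bs))) len)
  cnt′ : ∀ {j} → 1 ≤ j → j ≤ n → count j (as ++ bs) ≡ 1
  cnt′ {j} 1≤j j≤n =
    trans (cong (λ b → ⟦ b ⟧ + count j (as ++ bs)) (sym (≡ᵇ-false (<⇒≢ (s≤s j≤n) ∘ sym))))
          (trans (sym (∑-↭ _ (shift (suc n) as bs))) (cnt 1≤j (m≤n⇒m≤1+n j≤n)))

words-∋ : ∀ m {n} w → length w ≡ m → (∀ {y} → y ∈ w → 1 ≤ y × y ≤ n) → w ∈ words m n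
words-∋ zero    []      _   _     = here refl
words-∋ (suc m) (y ∷ w) len range =
  ∈-concat⁺′ (∈-map⁺ (y ∷_) (words-∋ m w (suc-injective len) (range ∘ there)))
             (∈-map⁺ (λ x → map (x ∷_) (words m _)) (∈-range1⁺ (proj₁ (range (here refl))) (proj₂ (range (here refl)))))

unique-words : ∀ m n → Unique (words m n)
unique-words zero    n = All.[] AllPairs.∷ AllPairs.[]
unique-words (suc m) n =
  Unique.concat⁺ (All.map⁺ (All.tabulate (λ _ → Unique.map⁺ ∷-injectiveʳ (unique-words m n))))
                 (AllPairs.map⁺ (AllPairs.map disjoint (unique-range1 n)))
  where
  disjoint : ∀ {x y} → x ≢ y → Disjoint (map (x ∷_) (words m n)) (map (y ∷_) (words m n))
  disjoint x≢y (v∈x , v∈y) with ∈-map⁻ (_ ∷_) v∈x | ∈-map⁻ (_ ∷_) v∈y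
  ... | _ , _ , refl | _ , _ , eq = x≢y (∷-injectiveˡ eq)

unique-Sym : ∀ n → Unique (Sym n)
unique-Sym n = unique-boolFilter (isPerm n) (unique-words n n)

Perm⇒∈Sym : ∀ {n π} → Perm n π → π ∈ Sym n
Perm⇒∈Sym {n} {π} P = ∈-boolFilter⁺ (words-∋ n π (perm-length P) (perm-∈ P))
  (∧-true⁺ (≡ᵇ-true (perm-length P)) (allB-true⁺ (range1 n) λ j∈ →
    ≡ᵇ-true (trans (length-boolFilter _ π) (count-perm P (proj₁ (∈-range1⁻ j∈)) (proj₂ (∈-range1⁻ j∈))))))

∈Sym⇒Perm : ∀ {n π} → π ∈ Sym n → Perm n π
∈Sym⇒Perm {n} {π} π∈ = counts⇒perm n (≡ᵇ-sound len) λ 1≤j j≤n →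
  trans (sym (length-boolFilter _ π)) (≡ᵇ-sound (allB-true⁻ counts (∈-range1⁺ 1≤j j≤n)))
  where
  len,counts : (length π ≡ᵇ n) ≡ true × allB (λ j → countB (_≡ᵇ j) π ≡ᵇ 1) (range1 n) ≡ true
  len,counts = ∧-true⁻ (proj₂ (∈-boolFilter⁻ (words n n) π∈))
  len = proj₁ len,counts
  counts = proj₂ len,counts

Exchanges : MeshPattern → MeshPattern → (List ℕ → List ℕ) → List ℕ → Set
Exchanges p q f π = occ p (f π) ≡ occ q π × occ q (f π) ≡ occ p π

record Exchanger (p q : MeshPattern) : Set where
  field
    exchange   : ℕ → List ℕ → List ℕ
    perm       : ∀ n {π} → Perm n π → Perm n (exchange n π)
    involutive : ∀ n {π} → Perm n π → exchange n (exchange n π) ≡ π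
    exchanges  : ∀ n {π} → Perm n π → Exchanges p q (exchange n) π

exchanger⇒equidistributed : ∀ {p q} → Exchanger p q → JointlyEquidistributed p q
exchanger⇒equidistributed {p} {q} E n _ k ℓ =
  length-boolFilter-involution (exchange n) (unique-Sym n)
    (Perm⇒∈Sym ∘ perm n ∘ ∈Sym⇒Perm) (involutive n ∘ ∈Sym⇒Perm) swapped
  where
  open Exchanger E
  swapped : ∀ {π} → π ∈ Sym n → ((occ p (exchange n π) ≡ᵇ k) ∧ (occ q (exchange n π) ≡ᵇ ℓ)) ≡ ((occ p π ≡ᵇ ℓ) ∧ (occ q π ≡ᵇ k))
  swapped {π} π∈ with exchanges n (∈Sym⇒Perm π∈)
  ... | p≡q , q≡p rewrite p≡q | q≡p = ∧-comm (occ q π ≡ᵇ k) (occ p π ≡ᵇ ℓ)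

-- Decomposing a permutation by its first entry

bump : ℕ → ℕ → ℕ
bump x y = if y <ᵇ x then y else suc y

unbump : ℕ → ℕ → ℕ
unbump x y = if x <ᵇ y then pred y else y

module _ {x y : ℕ} where

  bump-< : y < x → bump x y ≡ y
  bump-< y<x rewrite <ᵇ-true y<x = refl

  bump-≥ : x ≤ y → bump x y ≡ suc y
  bump-≥ x≤y rewrite <ᵇ-false (≤⇒≯ x≤y) = refl

  unbump-≤ : y ≤ x → unbump x y ≡ y
  unbump-≤ y≤x rewrite <ᵇ-false (≤⇒≯ y≤x) = refl

  unbump-> : x < y → unbump x y ≡ pred y
  unbump-> x<y rewrite <ᵇ-true x<y = refl

unbump-bump : ∀ x y → unbump x (bump x y) ≡ y
unbump-bump x y with y <? x
... | yes y<x rewrite bump-< y<x = unbump-≤ (<⇒≤ y<x)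
... | no  y≮x rewrite bump-≥ (≮⇒≥ y≮x) = unbump-> (s≤s (≮⇒≥ y≮x))

bump-unbump : ∀ x y → y ≢ x → bump x (unbump x y) ≡ y
bump-unbump x y y≢x with <-cmp y x
... | tri< y<x _ _   rewrite unbump-≤ (<⇒≤ y<x) = bump-< y<x
... | tri≈ _ y≡x _   = ⊥-elim (y≢x y≡x)
... | tri> _ _ x<y@(s≤s x≤y′) rewrite unbump-> x<y = bump-≥ x≤y′

bump-injective : ∀ x {a b} → bump x a ≡ bump x b → a ≡ b
bump-injective x {a} {b} eq = trans (sym (unbump-bump x a)) (trans (cong (unbump x) eq) (unbump-bump x b))

bump-≢ : ∀ x y → bump x y ≢ x
bump-≢ x y with y <? x
... | yes y<x rewrite bump-< y<x = <⇒≢ y<x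
... | no  y≮x rewrite bump-≥ (≮⇒≥ y≮x) = λ eq → 1+n≰n (≤-trans (≤-reflexive eq) (≮⇒≥ y≮x))

bump-<ᵇ : ∀ x a b → (bump x a <ᵇ bump x b) ≡ (a <ᵇ b)
bump-<ᵇ x a b with a <? x | b <? x
... | yes a<x | yes b<x rewrite bump-< a<x | bump-< b<x = refl
... | yes a<x | no  b≮x rewrite bump-< a<x | bump-≥ (≮⇒≥ b≮x)
  = trans (<ᵇ-true (m<n⇒m<1+n a<b)) (sym (<ᵇ-true a<b))
  where a<b = <-≤-trans a<x (≮⇒≥ b≮x)
... | no  a≮x | yes b<x rewrite bump-≥ (≮⇒≥ a≮x) | bump-< b<x
  = trans (<ᵇ-false (<-asym (m<n⇒m<1+n b<a))) (sym (<ᵇ-false (<-asym b<a)))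
  where b<a = <-≤-trans b<x (≮⇒≥ a≮x)
... | no  a≮x | no  b≮x rewrite bump-≥ (≮⇒≥ a≮x) | bump-≥ (≮⇒≥ b≮x) = refl

bump-zero : ∀ {x} → 1 ≤ x → bump x 0 ≡ 0
bump-zero (s≤s _) = refl

bump-≡ᵇ-suc : ∀ {x v} y → x ≤ v → (bump x y ≡ᵇ suc v) ≡ (y ≡ᵇ v)
bump-≡ᵇ-suc {x} {v} y x≤v with y <? x
... | yes y<x rewrite bump-< y<x = trans (≡ᵇ-false (<⇒≢ (m<n⇒m<1+n y<v))) (sym (≡ᵇ-false (<⇒≢ y<v)))
  where y<v = <-≤-trans y<x x≤v
... | no  y≮x rewrite bump-≥ (≮⇒≥ y≮x) = refl

unbump-bump-map : ∀ x σ → map (unbump x) (map (bump x) σ) ≡ σ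
unbump-bump-map x σ = trans (sym (map-∘ σ)) (trans (map-cong (unbump-bump x) σ) (map-id σ))

count-bump-self : ∀ x σ → count x (map (bump x) σ) ≡ 0
count-bump-self x σ = count-absent (map (bump x) σ) λ z∈ → case ∈-map⁻ (bump x) z∈ of λ where
  (y , _ , refl) → bump-≢ x y

count-bump-perm : ∀ {n σ v} x → Perm n σ → 1 ≤ v → v ≤ n → count (bump x v) (map (bump x) σ) ≡ 1
count-bump-perm {σ = σ} {v} x P 1≤v v≤n = trans (count-map (bump-injective x) v σ) (count-perm P 1≤v v≤n)

nth-bump : ∀ {x} σ {m} → 1 ≤ x → 1 ≤ m → nth (x ∷ map (bump x) σ) (suc m) ≡ bump x (nth σ m)
nth-bump {x} σ {m} 1≤x 1≤m = trans (nth-∷ x (map (bump x) σ) 1≤m) (nth-map (bump-zero 1≤x) σ m)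

-- For σ ∈ S_n and r ≤ n, the permutation r ⊳⟨ n ⟩ σ ∈ S_{n+1} starts with the
-- value exceeded by exactly r later entries; the rest is order-isomorphic to σ.
_⊳⟨_⟩_ : ℕ → ℕ → List ℕ → List ℕ
r ⊳⟨ n ⟩ σ = (suc n ∸ r) ∷ map (bump (suc n ∸ r)) σ

bump-range1 : ∀ n x → 1 ≤ x → x ≤ suc n → x ∷ map (bump x) (range1 n) ↭ range1 (suc n)
bump-range1 n x 1≤x x≤1+n with m≤n⇒m<n∨m≡n x≤1+n
... | inj₂ refl = ↭-trans (prep x (↭-reflexive below)) (↭-trans (∷↭∷ʳ x (range1 n)) (↭-reflexive (sym (range1-∷ʳ n))))
  where
  below : map (bump (suc n)) (range1 n) ≡ range1 n
  below = map-id-local (All.tabulate (λ y∈ → bump-< (s≤s (proj₂ (∈-range1⁻ y∈)))))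
bump-range1 (suc n) x 1≤x x≤1+n | inj₁ (s≤s x≤n) = begin
  x ∷ map (bump x) (range1 (suc n))              ≡⟨ cong (λ l → x ∷ map (bump x) l) (range1-∷ʳ n) ⟩
  x ∷ map (bump x) (range1 n ∷ʳ suc n)           ≡⟨ cong (x ∷_) (map-++ (bump x) (range1 n) [ suc n ]) ⟩
  x ∷ map (bump x) (range1 n) ∷ʳ bump x (suc n)  ≡⟨ cong (λ z → x ∷ map (bump x) (range1 n) ∷ʳ z) (bump-≥ x≤n) ⟩
  (x ∷ map (bump x) (range1 n)) ∷ʳ suc (suc n)   ↭⟨ ++⁺ʳ [ suc (suc n) ] (bump-range1 n x 1≤x x≤n) ⟩
  range1 (suc n) ∷ʳ suc (suc n)                  ≡⟨ sym (range1-∷ʳ (suc n)) ⟩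
  range1 (suc (suc n))                           ∎
  where open PermutationReasoning
bump-range1 zero (suc x) _ _ | inj₁ (s≤s ())

⊳-head-bounds : ∀ n r → r ≤ n → 1 ≤ suc n ∸ r × suc n ∸ r ≤ suc n
⊳-head-bounds n r r≤n = m<n⇒0<n∸m (s≤s r≤n) , m∸n≤m (suc n) r

perm-⊳ : ∀ {n r σ} → Perm n σ → r ≤ n → Perm (suc n) (r ⊳⟨ n ⟩ σ)
perm-⊳ {n} {r} {σ} P r≤n =
  ↭-trans (prep x (map⁺ (bump x) P)) (bump-range1 n x (proj₁ bounds) (proj₂ bounds))
  where
  x = suc n ∸ r
  bounds : 1 ≤ x × x ≤ suc n
  bounds = ⊳-head-bounds n r r≤n

⊳-view : ∀ {n π} → Perm (suc n) π → ∃[ r ] ∃[ σ ] (r ≤ n × Perm n σ × π ≡ r ⊳⟨ n ⟩ σ)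
⊳-view {π = []} P = ⊥-elim (0≢1+n (perm-length P))
⊳-view {n} {x ∷ τ} P = suc n ∸ x , σ , r≤n , Pσ , π≡
  where
  σ = map (unbump x) τ
  x-bounds : 1 ≤ x × x ≤ suc n
  x-bounds = perm-∈ P (here refl)
  r≤n : suc n ∸ x ≤ n
  r≤n = ∸-monoʳ-≤ (suc n) (proj₁ x-bounds)
  Pσ : Perm n σ
  Pσ = drop-∷ (begin
    x ∷ σ                                         ≡⟨ cong (_∷ σ) (sym (unbump-≤ ≤-refl)) ⟩
    map (unbump x) (x ∷ τ)                        ↭⟨ map⁺ (unbump x) P ⟩
    map (unbump x) (range1 (suc n))               ↭⟨ map⁺ (unbump x) (↭-sym (bump-range1 n x (proj₁ x-bounds) (proj₂ x-bounds))) ⟩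
    map (unbump x) (x ∷ map (bump x) (range1 n))  ≡⟨ cong₂ _∷_ (unbump-≤ ≤-refl) (unbump-bump-map x (range1 n)) ⟩
    x ∷ range1 n                                  ∎)
    where open PermutationReasoning
  x∉τ : x ∉ τ
  x∉τ = count-∷≡1⇒∉ τ (count-perm P (proj₁ x-bounds) (proj₂ x-bounds))
  π≡ : x ∷ τ ≡ (suc n ∸ x) ⊳⟨ n ⟩ σ
  π≡ rewrite m∸[m∸n]≡n (proj₂ x-bounds) =
    cong (x ∷_) (sym (trans (sym (map-∘ τ))
      (map-id-local (All.tabulate (λ {y} y∈ → bump-unbump x y (λ y≡x → x∉τ (subst (_∈ τ) y≡x y∈)))))))

⊳-elim : ∀ {n} (Q : List ℕ → Set) → (∀ {r σ} → r ≤ n → Perm n σ → Q (r ⊳⟨ n ⟩ σ)) → ∀ {π} → Perm (suc n) π → Q π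
⊳-elim Q step P with ⊳-view P
... | _ , _ , r≤n , Pσ , refl = step r≤n Pσ

perm₀ : ∀ {π} → Perm 0 π → π ≡ []
perm₀ = ↭-empty-inv

perm₁ : ∀ {π} → Perm 1 π → π ≡ 1 ∷ []
perm₁ = ↭-singleton-inv

perm₂ : ∀ {π} → Perm 2 π → π ≡ 1 ∷ 2 ∷ [] ⊎ π ≡ 2 ∷ 1 ∷ []
perm₂ P with ⊳-view P
... | 0 , σ , _ , Pσ , refl rewrite perm₁ Pσ = inj₂ refl
... | 1 , σ , _ , Pσ , refl rewrite perm₁ Pσ = inj₁ refl
... | suc (suc _) , _ , s≤s () , _ , _

-- The relative order of the two largest values

before : ℕ → ℕ → List ℕ → ℕ
before a b []      = 0
before a b (y ∷ ρ) = ⟦ y ≡ᵇ a ⟧ * count b ρ + before a b ρ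

before-absentˡ : ∀ {a b} ρ → count a ρ ≡ 0 → before a b ρ ≡ 0
before-absentˡ []      _   = refl
before-absentˡ (y ∷ ρ) ca≡0
  rewrite m+n≡0⇒m≡0 ⟦ y ≡ᵇ _ ⟧ ca≡0 = before-absentˡ ρ (m+n≡0⇒n≡0 ⟦ y ≡ᵇ _ ⟧ ca≡0)

before-absentʳ : ∀ {a b} ρ → count b ρ ≡ 0 → before a b ρ ≡ 0
before-absentʳ []      _   = refl
before-absentʳ {a} (y ∷ ρ) cb≡0
  rewrite m+n≡0⇒n≡0 ⟦ y ≡ᵇ _ ⟧ cb≡0 | *-zeroʳ ⟦ y ≡ᵇ a ⟧ = before-absentʳ ρ (m+n≡0⇒n≡0 ⟦ y ≡ᵇ _ ⟧ cb≡0)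

before-map : ∀ {f : ℕ → ℕ} → (∀ {a b} → f a ≡ f b → a ≡ b) → ∀ a b ρ → before (f a) (f b) (map f ρ) ≡ before a b ρ
before-map inj a b []      = refl
before-map inj a b (y ∷ ρ) =
  cong₂ _+_ (cong₂ _*_ (cong ⟦_⟧ (≡ᵇ-injective inj a y)) (count-map inj b ρ)) (before-map inj a b ρ)

before-bump : ∀ x {a b} → x ≤ a → x ≤ b → ∀ σ → before (suc a) (suc b) (map (bump x) σ) ≡ before a b σ
before-bump x x≤a x≤b σ =
  trans (cong₂ (λ a′ b′ → before a′ b′ (map (bump x) σ)) (sym (bump-≥ x≤a)) (sym (bump-≥ x≤b)))
        (before-map (bump-injective x) _ _ σ)

before+before : ∀ {a b} → a ≢ b → ∀ ρ → before a b ρ + before b a ρ ≡ count a ρ * count b ρ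
before+before a≢b []      = refl
before+before {a} {b} a≢b (y ∷ ρ) =
  step ⟦ y ≡ᵇ a ⟧ ⟦ y ≡ᵇ b ⟧ (count a ρ) (count b ρ) _ _ disjoint (before+before a≢b ρ)
  where
  disjoint : ⟦ y ≡ᵇ a ⟧ * ⟦ y ≡ᵇ b ⟧ ≡ 0
  disjoint with y ≟ a
  ... | yes refl rewrite ≡ᵇ-false a≢b = *-zeroʳ ⟦ y ≡ᵇ y ⟧
  ... | no  y≢a  rewrite ≡ᵇ-false y≢a = refl
  step : ∀ i j ca cb x z → i * j ≡ 0 → x + z ≡ ca * cb → (i * cb + x) + (j * ca + z) ≡ (i + ca) * (j + cb)
  step i j ca cb x z ij≡0 xz≡ = begin
    (i * cb + x) + (j * ca + z)        ≡⟨ regroup i j ca cb x z ⟩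
    0 + i * cb + j * ca + (x + z)      ≡⟨ cong₂ (λ u v → u + i * cb + j * ca + v) (sym ij≡0) xz≡ ⟩
    i * j + i * cb + j * ca + ca * cb  ≡⟨ expand i j ca cb ⟩
    (i + ca) * (j + cb)                ∎
    where
    open ≡-Reasoning
    regroup : ∀ i j ca cb x z → (i * cb + x) + (j * ca + z) ≡ 0 + i * cb + j * ca + (x + z)
    regroup = solve-∀
    expand : ∀ i j ca cb → i * j + i * cb + j * ca + ca * cb ≡ (i + ca) * (j + cb)
    expand = solve-∀

before-positions : ∀ a b ρ →
  ∑ (positions ρ) (λ j → ∑ (positions ρ) λ k → ⟦ j <ᵇ k ⟧ * (⟦ nth ρ j ≡ᵇ a ⟧ * ⟦ nth ρ k ≡ᵇ b ⟧)) ≡ before a b ρ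
before-positions a b []      = refl
before-positions a b (y ∷ ρ) = begin
  ∑ S′ (λ j → ∑ S′ (F j))                                 ≡⟨ ∑-range1-suc (length ρ) _ ⟩
  ∑ S′ (F 1) + ∑ S (λ j → ∑ S′ (F (suc j)))               ≡⟨ cong₂ _+_ first-row (∑-cong S later-row) ⟩
  ⟦ y ≡ᵇ a ⟧ * count b ρ + ∑ S (λ j → ∑ S (λ k → G j k))  ≡⟨ cong (⟦ y ≡ᵇ a ⟧ * count b ρ +_) (before-positions a b ρ) ⟩
  ⟦ y ≡ᵇ a ⟧ * count b ρ + before a b ρ                   ∎
  where
  open ≡-Reasoning
  S = positions ρ
  S′ = range1 (suc (length ρ))
  F G : ℕ → ℕ → ℕ
  F j k = ⟦ j <ᵇ k ⟧ * (⟦ nth (y ∷ ρ) j ≡ᵇ a ⟧ * ⟦ nth (y ∷ ρ) k ≡ᵇ b ⟧)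
  G j k = ⟦ j <ᵇ k ⟧ * (⟦ nth ρ j ≡ᵇ a ⟧ * ⟦ nth ρ k ≡ᵇ b ⟧)
  first-row : ∑ S′ (F 1) ≡ ⟦ y ≡ᵇ a ⟧ * count b ρ
  first-row = begin
    ∑ S′ (F 1)                                 ≡⟨ ∑-range1-suc (length ρ) (F 1) ⟩
    ∑ S (F 1 ∘ suc)                            ≡⟨ ∑-cong S (λ {k} k∈ → entry (proj₁ (∈-range1⁻ k∈))) ⟩
    ∑ S (λ k → ⟦ y ≡ᵇ a ⟧ * ⟦ nth ρ k ≡ᵇ b ⟧)  ≡⟨ ∑-*ˡ S ⟦ y ≡ᵇ a ⟧ _ ⟩
    ⟦ y ≡ᵇ a ⟧ * ∑ S (λ k → ⟦ nth ρ k ≡ᵇ b ⟧)  ≡⟨ cong (⟦ y ≡ᵇ a ⟧ *_) (∑-positions ρ (λ z → ⟦ z ≡ᵇ b ⟧)) ⟩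
    ⟦ y ≡ᵇ a ⟧ * count b ρ                     ∎
    where
    entry : ∀ {k} → 1 ≤ k → F 1 (suc k) ≡ ⟦ y ≡ᵇ a ⟧ * ⟦ nth ρ k ≡ᵇ b ⟧
    entry {suc k} _ = +-identityʳ _
  later-row : ∀ {j} → j ∈ S → ∑ S′ (F (suc j)) ≡ ∑ S (G j)
  later-row {j} j∈ = trans (∑-range1-suc (length ρ) (F (suc j)))
    (∑-cong S λ {k} k∈ → cong₂ (λ u w → ⟦ j <ᵇ k ⟧ * (⟦ u ≡ᵇ a ⟧ * ⟦ w ≡ᵇ b ⟧))
                                (nth-∷ y ρ (proj₁ (∈-range1⁻ j∈))) (nth-∷ y ρ (proj₁ (∈-range1⁻ k∈))))

topAscent topDescent : List ℕ → ℕ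
topAscent   ρ = before (pred (length ρ)) (length ρ) ρ
topDescent ρ = before (length ρ) (pred (length ρ)) ρ

ascendingTop : List ℕ → Bool
ascendingTop ρ = topAscent ρ ≡ᵇ 1

topAscent-perm : ∀ {n ρ} → Perm n ρ → topAscent ρ ≡ before (pred n) n ρ
topAscent-perm {ρ = ρ} P = cong (λ m → before (pred m) m ρ) (perm-length P)

topDescent-perm : ∀ {n ρ} → Perm n ρ → topDescent ρ ≡ before n (pred n) ρ
topDescent-perm {ρ = ρ} P = cong (λ m → before m (pred m) ρ) (perm-length P)

topAscent+topDescent : ∀ {n ρ} → Perm n ρ → 2 ≤ n → topAscent ρ + topDescent ρ ≡ 1
topAscent+topDescent {suc zero} _ (s≤s ())
topAscent+topDescent {suc (suc m)} {ρ} P _ rewrite perm-length P =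
  trans (before+before (<⇒≢ (n<1+n (suc m))) ρ)
        (cong₂ _*_ (count-perm P (s≤s z≤n) (n≤1+n _)) (count-perm P (s≤s z≤n) ≤-refl))

orientation : ∀ {n ρ} → Perm n ρ → 2 ≤ n → topAscent ρ ≡ ⟦ ascendingTop ρ ⟧ × topDescent ρ ≡ ⟦ not (ascendingTop ρ) ⟧
orientation {ρ = ρ} P 2≤n with topAscent ρ | topAscent+topDescent P 2≤n
... | 0 | d≡1 = refl , d≡1
... | 1 | 1+d≡1 = refl , suc-injective 1+d≡1
... | suc (suc _) | ()

before-⊳-ascent : ∀ {n r σ} → Perm n σ → r ≤ n →
              before n (suc n) (r ⊳⟨ n ⟩ σ) ≡ ⟦ r ≡ᵇ 1 ⟧ + ⟦ 1 <ᵇ r ⟧ * before (pred n) n σ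
before-⊳-ascent {n} {zero} {σ} P _
  rewrite count-bump-self (suc n) σ | before-absentʳ {n} (map (bump (suc n)) σ) (count-bump-self (suc n) σ)
  = trans (+-identityʳ _) (*-zeroʳ ⟦ suc n ≡ᵇ n ⟧)
before-⊳-ascent {suc m} {suc zero} {σ} P _ =
  cong₂ _+_ (cong₂ _*_ (cong ⟦_⟧ (≡ᵇ-true {suc m} refl))
                       (trans (cong (λ v → count v (map (bump (suc m)) σ)) (sym (bump-≥ ≤-refl)))
                              (count-bump-perm (suc m) P (s≤s z≤n) ≤-refl)))
            (before-absentˡ (map (bump (suc m)) σ) (count-bump-self (suc m) σ))
before-⊳-ascent {suc m} {suc (suc r)} {σ} P (s≤s r<m)
  rewrite ≡ᵇ-false {m ∸ r} {suc m} (<⇒≢ (s≤s (m∸n≤m m r)))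
  = trans (before-bump (m ∸ r) (m∸n≤m m r) (m≤n⇒m≤1+n (m∸n≤m m r)) σ) (sym (+-identityʳ _))

before-⊳-descent : ∀ {n r σ} → Perm n σ → 1 ≤ n → r ≤ n →
                before (suc n) n (r ⊳⟨ n ⟩ σ) ≡ ⟦ r ≡ᵇ 0 ⟧ + ⟦ 1 <ᵇ r ⟧ * before n (pred n) σ
before-⊳-descent {suc m} {zero} {σ} P _ _ =
  cong₂ _+_ (cong₂ _*_ (cong ⟦_⟧ (≡ᵇ-true {suc (suc m)} refl))
                       (trans (cong (λ v → count v (map (bump (suc (suc m))) σ)) (sym (bump-< ≤-refl)))
                              (count-bump-perm (suc (suc m)) P (s≤s z≤n) ≤-refl)))
            (before-absentˡ (map (bump (suc (suc m))) σ) (count-bump-self (suc (suc m)) σ))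
before-⊳-descent {suc m} {suc zero} {σ} P _ _
  rewrite count-bump-self (suc m) σ | before-absentʳ {suc (suc m)} (map (bump (suc m)) σ) (count-bump-self (suc m) σ)
  = trans (+-identityʳ _) (*-zeroʳ ⟦ m ≡ᵇ suc m ⟧)
before-⊳-descent {suc m} {suc (suc r)} {σ} P _ (s≤s r<m)
  rewrite ≡ᵇ-false {m ∸ r} {suc (suc m)} (<⇒≢ (s≤s (m≤n⇒m≤1+n (m∸n≤m m r))))
  = trans (before-bump (m ∸ r) (m≤n⇒m≤1+n (m∸n≤m m r)) (m∸n≤m m r) σ) (sym (+-identityʳ _))

topAscent-⊳ : ∀ {n r σ} → Perm n σ → r ≤ n → topAscent (r ⊳⟨ n ⟩ σ) ≡ ⟦ r ≡ᵇ 1 ⟧ + ⟦ 1 <ᵇ r ⟧ * topAscent σ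
topAscent-⊳ {n} {r} {σ} P r≤n = begin
  topAscent (r ⊳⟨ n ⟩ σ)                         ≡⟨ topAscent-perm (perm-⊳ P r≤n) ⟩
  before n (suc n) (r ⊳⟨ n ⟩ σ)                  ≡⟨ before-⊳-ascent P r≤n ⟩
  ⟦ r ≡ᵇ 1 ⟧ + ⟦ 1 <ᵇ r ⟧ * before (pred n) n σ  ≡⟨ cong (λ u → ⟦ r ≡ᵇ 1 ⟧ + ⟦ 1 <ᵇ r ⟧ * u) (sym (topAscent-perm P)) ⟩
  ⟦ r ≡ᵇ 1 ⟧ + ⟦ 1 <ᵇ r ⟧ * topAscent σ          ∎
  where open ≡-Reasoning

topDescent-⊳ : ∀ {n r σ} → Perm n σ → 1 ≤ n → r ≤ n → topDescent (r ⊳⟨ n ⟩ σ) ≡ ⟦ r ≡ᵇ 0 ⟧ + ⟦ 1 <ᵇ r ⟧ * topDescent σ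
topDescent-⊳ {n} {r} {σ} P 1≤n r≤n = begin
  topDescent (r ⊳⟨ n ⟩ σ)                        ≡⟨ topDescent-perm (perm-⊳ P r≤n) ⟩
  before (suc n) n (r ⊳⟨ n ⟩ σ)                  ≡⟨ before-⊳-descent P 1≤n r≤n ⟩
  ⟦ r ≡ᵇ 0 ⟧ + ⟦ 1 <ᵇ r ⟧ * before n (pred n) σ  ≡⟨ cong (λ d → ⟦ r ≡ᵇ 0 ⟧ + ⟦ 1 <ᵇ r ⟧ * d) (sym (topDescent-perm P)) ⟩
  ⟦ r ≡ᵇ 0 ⟧ + ⟦ 1 <ᵇ r ⟧ * topDescent σ         ∎
  where open ≡-Reasoning

occurs : MeshPattern → List ℕ → ℕ → ℕ → ℕ → Bool
occurs p π i j k = strictlyIncreasing (i ∷ j ∷ k ∷ []) ∧ isOccurrence p π (i ∷ j ∷ k ∷ [])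

∑-words : ∀ m n (f : List ℕ → ℕ) → ∑ (words (suc m) n) f ≡ ∑ (range1 n) (λ i → ∑ (words m n) (f ∘ (i ∷_)))
∑-words m n f = trans (∑-concatMap _ (range1 n) f) (∑-cong (range1 n) (λ {i} _ → ∑-map (i ∷_) (words m n) f))

occ-∑³ : ∀ {a b c boxes} π → let p = mesh (a ∷ b ∷ c ∷ []) boxes in occ p π ≡ ∑³ (positions π) (λ i j k → ⟦ occurs p π i j k ⟧)
occ-∑³ {a} {b} {c} {boxes} π = begin
  occ p π                                                    ≡⟨ length-boolFilter-∧ strictlyIncreasing (isOccurrence p π) (words 3 N) ⟩
  ∑ (words 3 N) f                                            ≡⟨ ∑-words 2 N f ⟩
  ∑ P (λ i → ∑ (words 2 N) (f ∘ (i ∷_)))                     ≡⟨ ∑-cong P (λ {i} _ → ∑-words 1 N (f ∘ (i ∷_))) ⟩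
  ∑ P (λ i → ∑ P λ j → ∑ (words 1 N) (f ∘ (i ∷_) ∘ (j ∷_)))  ≡⟨ ∑-cong P (λ {i} _ → ∑-cong P (λ {j} _ → ∑-words 0 N (f ∘ (i ∷_) ∘ (j ∷_)))) ⟩
  ∑³ P (λ i j k → ⟦ occurs p π i j k ⟧ + 0)                  ≡⟨ ∑-cong P (λ _ → ∑-cong P (λ _ → ∑-cong P (λ _ → +-identityʳ _))) ⟩
  ∑³ P (λ i j k → ⟦ occurs p π i j k ⟧)                      ∎
  where
  open ≡-Reasoning
  p = mesh (a ∷ b ∷ c ∷ []) boxes
  N = length π
  P = positions π
  f : List ℕ → ℕ
  f is = ⟦ strictlyIncreasing is ∧ isOccurrence p π is ⟧

strictlyIncreasing-1 : ∀ i j → strictlyIncreasing (i ∷ j ∷ 1 ∷ []) ≡ false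
strictlyIncreasing-1 i zero    = refl
strictlyIncreasing-1 i (suc j) = ∧-zeroʳ (i <ᵇ suc j)

∑³-occurs-suc : ∀ n (G : ℕ → ℕ → ℕ → Bool) →
  ∑³ (range1 (suc n)) (λ i j k → ⟦ strictlyIncreasing (i ∷ j ∷ k ∷ []) ∧ G i j k ⟧) ≡
  ∑ (range1 n) (λ j → ∑ (range1 n) λ k → ⟦ strictlyIncreasing (1 ∷ suc j ∷ suc k ∷ []) ∧ G 1 (suc j) (suc k) ⟧) +
  ∑³ (range1 n) (λ i j k → ⟦ strictlyIncreasing (i ∷ j ∷ k ∷ []) ∧ G (suc i) (suc j) (suc k) ⟧)
∑³-occurs-suc n G = begin
  ∑ S′ (λ i → ∑ S′ λ j → ∑ S′ λ k → F i j k)  ≡⟨ ∑-range1-suc n _ ⟩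
  ∑ S′ (λ j → ∑ S′ λ k → F 1 j k) + ∑ S (λ i → ∑ S′ λ j → ∑ S′ λ k → F (suc i) j k)
    ≡⟨ cong₂ _+_ (drop-first-two 0) (∑-cong S (λ {i} _ → drop-first-two i)) ⟩
  ∑ S (λ j → ∑ S λ k → F 1 (suc j) (suc k)) + ∑ S (λ i → ∑ S λ j → ∑ S λ k → F (suc i) (suc j) (suc k)) ∎
  where
  open ≡-Reasoning
  S = range1 n
  S′ = range1 (suc n)
  F : ℕ → ℕ → ℕ → ℕ
  F i j k = ⟦ strictlyIncreasing (i ∷ j ∷ k ∷ []) ∧ G i j k ⟧
  drop-first : ∀ i j → ∑ S′ (F i j) ≡ ∑ S (F i j ∘ suc)
  drop-first i j = trans (∑-range1-suc n (F i j)) (cong (λ b → ⟦ b ∧ G i j 1 ⟧ + ∑ S (F i j ∘ suc)) (strictlyIncreasing-1 i j))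
  drop-first-two : ∀ i → ∑ S′ (λ j → ∑ S′ (F (suc i) j)) ≡ ∑ S (λ j → ∑ S (F (suc i) (suc j) ∘ suc))
  drop-first-two i = trans (∑-range1-suc n _)
    (cong₂ _+_ (∑-zero S′ (λ _ → refl)) (∑-cong S (λ {j} _ → drop-first (suc i) (suc j))))

inBox : List ℕ → List ℕ → List ℕ → ℕ × ℕ → ℕ → Bool
inBox π I V (a , b) m =
  (nth I (suc a) <ᵇ m) ∧ (m <ᵇ nth I (suc (suc a))) ∧ (nth V (suc b) <ᵇ nth π m) ∧ (nth π m <ᵇ nth V (suc (suc b)))

module _ {f : ℕ → ℕ} (f-<ᵇ : ∀ a b → (f a <ᵇ f b) ≡ (a <ᵇ b)) where

  insert-map : ∀ x l → insert (f x) (map f l) ≡ map f (insert x l)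
  insert-map x []      = refl
  insert-map x (y ∷ l) rewrite ≤ᵇ≡not<ᵇ (f x) (f y) | ≤ᵇ≡not<ᵇ x y | f-<ᵇ y x with y <ᵇ x
  ... | true  = cong (f y ∷_) (insert-map x l)
  ... | false = refl

  sort-map : ∀ l → sort (map f l) ≡ map f (sort l)
  sort-map []      = refl
  sort-map (x ∷ l) = trans (cong (insert (f x)) (sort-map l)) (insert-map x (sort l))

sort-increasing : ∀ {u v w} → u < v → v < w → sort (u ∷ v ∷ w ∷ []) ≡ u ∷ v ∷ w ∷ []
sort-increasing u<v v<w rewrite ≤ᵇ-true (<⇒≤ v<w) | ≤ᵇ-true (<⇒≤ u<v) = refl

sort-decreasing : ∀ {u v w} → u < v → v < w → sort (w ∷ v ∷ u ∷ []) ≡ u ∷ v ∷ w ∷ []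
sort-decreasing u<v v<w rewrite ≤ᵇ-false u<v | ≤ᵇ-false (<-trans u<v v<w) | ≤ᵇ-false v<w = refl

orderIso-pair : ∀ τ π is {a b} → orderIso τ π is ≡ true → a ∈ range1 (length τ) → b ∈ range1 (length τ) →
                iff (nth π (nth is a) <ᵇ nth π (nth is b)) (nth τ a <ᵇ nth τ b) ≡ true
orderIso-pair τ π is oi a∈ b∈ = allB-true⁻ (allB-true⁻ (proj₂ (∧-true⁻ {length is ≡ᵇ length τ} oi)) a∈) b∈

orderIso-123 : ∀ π i j k → orderIso p123 π (i ∷ j ∷ k ∷ []) ≡ (nth π i <ᵇ nth π j) ∧ (nth π j <ᵇ nth π k)
orderIso-123 π i j k = values (nth π i) (nth π j) (nth π k)
  where
  values : ∀ u v w → orderIso p123 (u ∷ v ∷ w ∷ []) (1 ∷ 2 ∷ 3 ∷ []) ≡ (u <ᵇ v) ∧ (v <ᵇ w)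
  values u v w = bool-ext elim intro
    where
    elim : orderIso p123 (u ∷ v ∷ w ∷ []) (1 ∷ 2 ∷ 3 ∷ []) ≡ true → (u <ᵇ v) ∧ (v <ᵇ w) ≡ true
    elim oi = ∧-true⁺
      (trans (sym (iff-true (u <ᵇ v))) (orderIso-pair p123 (u ∷ v ∷ w ∷ []) (1 ∷ 2 ∷ 3 ∷ []) oi (here refl) (there (here refl))))
      (trans (sym (iff-true (v <ᵇ w))) (orderIso-pair p123 (u ∷ v ∷ w ∷ []) (1 ∷ 2 ∷ 3 ∷ []) oi (there (here refl)) (there (there (here refl)))))
    intro : (u <ᵇ v) ∧ (v <ᵇ w) ≡ true → orderIso p123 (u ∷ v ∷ w ∷ []) (1 ∷ 2 ∷ 3 ∷ []) ≡ true
    intro uvw = increasing (<ᵇ-sound (proj₁ (∧-true⁻ {u <ᵇ v} uvw))) (<ᵇ-sound (proj₂ (∧-true⁻ {u <ᵇ v} uvw)))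
      where
      increasing : u < v → v < w → orderIso p123 (u ∷ v ∷ w ∷ []) (1 ∷ 2 ∷ 3 ∷ []) ≡ true
      increasing u<v v<w rewrite <ᵇ-true u<v | <ᵇ-true v<w | <ᵇ-true (<-trans u<v v<w)
                               | <ᵇ-irrefl u | <ᵇ-irrefl v | <ᵇ-irrefl w
                               | <ᵇ-false (<-asym u<v) | <ᵇ-false (<-asym v<w) | <ᵇ-false (<-asym (<-trans u<v v<w)) = refl

orderIso-321 : ∀ π i j k → orderIso p321 π (i ∷ j ∷ k ∷ []) ≡ (nth π j <ᵇ nth π i) ∧ (nth π k <ᵇ nth π j)
orderIso-321 π i j k = values (nth π i) (nth π j) (nth π k)
  where
  values : ∀ u v w → orderIso p321 (u ∷ v ∷ w ∷ []) (1 ∷ 2 ∷ 3 ∷ []) ≡ (v <ᵇ u) ∧ (w <ᵇ v)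
  values u v w = bool-ext elim intro
    where
    elim : orderIso p321 (u ∷ v ∷ w ∷ []) (1 ∷ 2 ∷ 3 ∷ []) ≡ true → (v <ᵇ u) ∧ (w <ᵇ v) ≡ true
    elim oi = ∧-true⁺
      (trans (sym (iff-true (v <ᵇ u))) (orderIso-pair p321 (u ∷ v ∷ w ∷ []) (1 ∷ 2 ∷ 3 ∷ []) oi (there (here refl)) (here refl)))
      (trans (sym (iff-true (w <ᵇ v))) (orderIso-pair p321 (u ∷ v ∷ w ∷ []) (1 ∷ 2 ∷ 3 ∷ []) oi (there (there (here refl))) (there (here refl))))
    intro : (v <ᵇ u) ∧ (w <ᵇ v) ≡ true → orderIso p321 (u ∷ v ∷ w ∷ []) (1 ∷ 2 ∷ 3 ∷ []) ≡ true
    intro vuw = decreasing (<ᵇ-sound (proj₁ (∧-true⁻ {v <ᵇ u} vuw))) (<ᵇ-sound (proj₂ (∧-true⁻ {v <ᵇ u} vuw)))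
      where
      decreasing : v < u → w < v → orderIso p321 (u ∷ v ∷ w ∷ []) (1 ∷ 2 ∷ 3 ∷ []) ≡ true
      decreasing v<u w<v rewrite <ᵇ-true v<u | <ᵇ-true w<v | <ᵇ-true (<-trans w<v v<u)
                               | <ᵇ-irrefl u | <ᵇ-irrefl v | <ᵇ-irrefl w
                               | <ᵇ-false (<-asym v<u) | <ᵇ-false (<-asym w<v) | <ᵇ-false (<-asym (<-trans w<v v<u)) = refl

∈-square⁺ : ∀ {S a b} → a ∈ S → b ∈ S → (a , b) ∈ square S
∈-square⁺ {S} a∈ b∈ = ∈-concat⁺′ (∈-map⁺ (_ ,_) b∈) (∈-map⁺ (λ a → map (a ,_) S) a∈)

∈-square⁻ : ∀ S {a b} → (a , b) ∈ square S → a ∈ S × b ∈ S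
∈-square⁻ S ab∈ with ∈-concat⁻′ (map (λ a → map (a ,_) S) S) ab∈
... | _ , ab∈row , row∈ with ∈-map⁻ (λ a → map (a ,_) S) row∈
...   | a , a∈ , refl with ∈-map⁻ (a ,_) ab∈row
...     | b , b∈ , refl = a∈ , b∈

∈-123⇒≤3 : ∀ {x} → x ∈ (1 ∷ 2 ∷ 3 ∷ []) → x ≤ 3
∈-123⇒≤3 (here refl)                 = s≤s z≤n
∈-123⇒≤3 (there (here refl))         = s≤s (s≤s z≤n)
∈-123⇒≤3 (there (there (here refl))) = ≤-refl

R₂-columns : All.All (λ box → 1 ≤ proj₁ box × proj₁ box ≤ 3) R₂
R₂-columns = from-yes (All.all? (λ box → 1 ≤? proj₁ box ×-dec proj₁ box ≤? 3) R₂)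

module _ {x : ℕ} (σ : List ℕ) (1≤x : 1 ≤ x) (x≤ : x ≤ suc (length σ)) where

  private
    π = x ∷ map (bump x) σ

    length-π : length π ≡ suc (length σ)
    length-π = cong suc (length-map (bump x) σ)

    nth-π : ∀ {m} → 1 ≤ m → nth π (suc m) ≡ bump x (nth σ m)
    nth-π = nth-bump σ 1≤x

    nth-π-shift : ∀ is → All.All (1 ≤_) is → ∀ a → nth π (nth (map suc is) a) ≡ bump x (nth σ (nth is a))
    nth-π-shift []       _            a             = sym (trans (cong (bump x) (nth-zero σ)) (bump-zero 1≤x))
    nth-π-shift (i ∷ is) _            zero          = sym (trans (cong (bump x) (nth-zero σ)) (bump-zero 1≤x))
    nth-π-shift (i ∷ is) (1≤i All.∷ _) (suc zero)    = nth-π 1≤i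
    nth-π-shift (i ∷ is) (_ All.∷ 1≤is) (suc (suc a)) = nth-π-shift is 1≤is (suc a)

  orderIso-shift : ∀ τ is → All.All (1 ≤_) is → orderIso τ π (map suc is) ≡ orderIso τ σ is
  orderIso-shift τ is 1≤is =
    cong₂ _∧_ (cong (_≡ᵇ length τ) (length-map suc is))
              (allB-cong (range1 (length τ)) λ {a} _ → allB-cong (range1 (length τ)) λ {b} _ →
                cong (λ c → iff c (nth τ a <ᵇ nth τ b))
                     (trans (cong₂ _<ᵇ_ (nth-π-shift is 1≤is a) (nth-π-shift is 1≤is b)) (bump-<ᵇ x _ _)))

  values-shift : ∀ is → All.All (1 ≤_) is →
    0 ∷ sort (map (nth π) (map suc is)) ++ [ suc (length π) ] ≡ map (bump x) (0 ∷ sort (map (nth σ) is) ++ [ suc (length σ) ])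
  values-shift is 1≤is = cong₂ _∷_ (sym (bump-zero 1≤x)) (begin
    sort (map (nth π) (map suc is)) ++ [ suc (length π) ]                ≡⟨ cong₂ (λ l m → sort l ++ [ suc m ]) entries length-π ⟩
    sort (map (bump x) (map (nth σ) is)) ++ [ suc (suc (length σ)) ]     ≡⟨ cong₂ (λ l m → l ++ [ m ]) (sort-map (bump-<ᵇ x) (map (nth σ) is)) (sym (bump-≥ x≤)) ⟩
    map (bump x) (sort (map (nth σ) is)) ++ [ bump x (suc (length σ)) ]  ≡⟨ sym (map-++ (bump x) _ [ suc (length σ) ]) ⟩
    map (bump x) (sort (map (nth σ) is) ++ [ suc (length σ) ])           ∎)
    where
    open ≡-Reasoning
    entries : map (nth π) (map suc is) ≡ map (bump x) (map (nth σ) is)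
    entries = trans (sym (map-∘ is)) (trans (map-cong-local (All.map nth-π 1≤is)) (map-∘ is))

  boxEmpty-shift : ∀ is V {a} b → 1 ≤ a → a ≤ length is →
    boxEmpty π (0 ∷ map suc is ++ [ suc (length π) ]) (map (bump x) V) (a , b) ≡ boxEmpty σ (0 ∷ is ++ [ suc (length σ) ]) V (a , b)
  boxEmpty-shift is V {a} b 1≤a a≤ = cong not (begin
    anyB (inBox π Iπ Vπ (a , b)) (range1 (length π))
      ≡⟨ cong (λ n → anyB (inBox π Iπ Vπ (a , b)) (range1 n)) length-π ⟩
    anyB (inBox π Iπ Vπ (a , b)) (range1 (suc (length σ)))
      ≡⟨ cong (anyB (inBox π Iπ Vπ (a , b))) (range1-suc (length σ)) ⟩
    inBox π Iπ Vπ (a , b) 1 ∨ anyB (inBox π Iπ Vπ (a , b)) (map suc (range1 (length σ)))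
      ≡⟨ cong₂ _∨_ first (anyB-map _ suc (range1 (length σ))) ⟩
    false ∨ anyB (inBox π Iπ Vπ (a , b) ∘ suc) (range1 (length σ))
      ≡⟨ anyB-cong (range1 (length σ)) (λ m∈ → rest (proj₁ (∈-range1⁻ m∈))) ⟩
    anyB (inBox σ I V (a , b)) (range1 (length σ)) ∎)
    where
    open ≡-Reasoning
    I = 0 ∷ is ++ [ suc (length σ) ]
    Iπ = 0 ∷ map suc is ++ [ suc (length π) ]
    Vπ = map (bump x) V
    tail-Iπ : map suc is ++ [ suc (length π) ] ≡ map suc (is ++ [ suc (length σ) ])
    tail-Iπ = trans (cong (λ m → map suc is ++ [ suc m ]) length-π) (sym (map-++ suc is _))
    column : ∀ {c} → 1 ≤ c → c ≤ suc (length is) → nth Iπ (suc c) ≡ suc (nth I (suc c))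
    column {suc c} 1≤c c≤ = trans (cong (λ l → nth l (suc c)) tail-Iπ)
      (nth-map-inside suc (is ++ [ suc (length σ) ]) 1≤c (subst (suc c ≤_) (sym (trans (length-++ is) (+-comm (length is) 1))) c≤))
    left = column 1≤a (m≤n⇒m≤1+n a≤)
    right = column (s≤s z≤n) (s≤s a≤)
    first : inBox π Iπ Vπ (a , b) 1 ≡ false
    first rewrite left = refl
    rest : ∀ {m} → 1 ≤ m → inBox π Iπ Vπ (a , b) (suc m) ≡ inBox σ I V (a , b) m
    rest {m} 1≤m = cong₂ _∧_ (cong (_<ᵇ suc m) left) (cong₂ _∧_ (cong (suc m <ᵇ_) right) (cong₂ _∧_
      (trans (cong₂ _<ᵇ_ (nth-map (bump-zero 1≤x) V (suc b)) (nth-π 1≤m)) (bump-<ᵇ x _ _))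
      (trans (cong₂ _<ᵇ_ (nth-π 1≤m) (nth-map (bump-zero 1≤x) V (suc (suc b)))) (bump-<ᵇ x _ _))))

  isOccurrence-shift : ∀ τ R is → All.All (1 ≤_) is → All.All (λ box → 1 ≤ proj₁ box × proj₁ box ≤ length is) R →
                       isOccurrence (mesh τ R) π (map suc is) ≡ isOccurrence (mesh τ R) σ is
  isOccurrence-shift τ R is 1≤is columns =
    cong₂ _∧_ (orderIso-shift τ is 1≤is)
      (trans (cong (λ V → allB (boxEmpty π Iπ V) R) (values-shift is 1≤is))
             (allB-cong R λ {box} box∈ → let 1≤a , a≤ = All.lookup columns box∈ in
               boxEmpty-shift is (0 ∷ sort (map (nth σ) is) ++ [ suc (length σ) ]) (proj₂ box) 1≤a a≤))
    where
    Iπ = 0 ∷ map suc is ++ [ suc (length π) ]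

anchoredOcc : MeshPattern → List ℕ → ℕ → ℕ
anchoredOcc p π n = ∑ (range1 n) λ j → ∑ (range1 n) λ k → ⟦ occurs p π 1 (suc j) (suc k) ⟧

occ-R₂-split : ∀ {a b c x} σ → 1 ≤ x → x ≤ suc (length σ) → let p = mesh (a ∷ b ∷ c ∷ []) R₂ ; π = x ∷ map (bump x) σ in
  occ p π ≡ anchoredOcc p π (length σ) + occ p σ
occ-R₂-split {a} {b} {c} {x} σ 1≤x x≤ = begin
  occ p π                                               ≡⟨ occ-∑³ {a} {b} {c} {R₂} π ⟩
  ∑³ (positions π) (λ i j k → ⟦ occurs p π i j k ⟧)     ≡⟨ cong (λ m → ∑³ (range1 m) (λ i j k → ⟦ occurs p π i j k ⟧)) (cong suc (length-map (bump x) σ)) ⟩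
  ∑³ (range1 (suc n)) (λ i j k → ⟦ occurs p π i j k ⟧)  ≡⟨ ∑³-occurs-suc n (λ i j k → isOccurrence p π (i ∷ j ∷ k ∷ [])) ⟩
  anchoredOcc p π n + ∑³ S (λ i j k → ⟦ occurs p π (suc i) (suc j) (suc k) ⟧)
    ≡⟨ cong (anchoredOcc p π n +_) (∑-cong S λ {i} i∈ → ∑-cong S λ {j} j∈ → ∑-cong S λ {k} k∈ →
         cong (λ o → ⟦ strictlyIncreasing (i ∷ j ∷ k ∷ []) ∧ o ⟧)
           (isOccurrence-shift σ 1≤x x≤ (a ∷ b ∷ c ∷ []) R₂ (i ∷ j ∷ k ∷ []) (1≤ i∈ All.∷ 1≤ j∈ All.∷ 1≤ k∈ All.∷ All.[]) R₂-columns)) ⟩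
  anchoredOcc p π n + ∑³ S (λ i j k → ⟦ occurs p σ i j k ⟧)  ≡⟨ cong (anchoredOcc p π n +_) (sym (occ-∑³ {a} {b} {c} {R₂} σ)) ⟩
  anchoredOcc p π n + occ p σ                                ∎
  where
  open ≡-Reasoning
  p = mesh (a ∷ b ∷ c ∷ []) R₂
  π = x ∷ map (bump x) σ
  n = length σ
  S = range1 n
  1≤ : ∀ {i} → i ∈ S → 1 ≤ i
  1≤ = proj₁ ∘ ∈-range1⁻

-- Occurrences at the first position for R₂

three-gaps : ∀ {lo p q hi m} → lo < p → p < q → q < hi → lo < m → m < hi → m ≢ p → m ≢ q →
      ∃[ s ] (s ∈ (1 ∷ 2 ∷ 3 ∷ []) × nth (0 ∷ lo ∷ p ∷ q ∷ hi ∷ []) (suc s) < m × m < nth (0 ∷ lo ∷ p ∷ q ∷ hi ∷ []) (suc (suc s)))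
three-gaps {lo} {p} {q} {hi} {m} lo<p p<q q<hi lo<m m<hi m≢p m≢q with <-cmp m p | <-cmp m q
... | tri< m<p _ _ | _            = 1 , here refl , lo<m , m<p
... | tri≈ _ m≡p _ | _            = ⊥-elim (m≢p m≡p)
... | tri> _ _ p<m | tri< m<q _ _ = 2 , there (here refl) , p<m , m<q
... | tri> _ _ _   | tri≈ _ m≡q _ = ⊥-elim (m≢q m≡q)
... | tri> _ _ _   | tri> _ _ q<m = 3 , there (there (here refl)) , q<m , m<hi

top-three : ∀ {N w₁ w₂ w₃} → w₁ < w₂ → w₂ < w₃ → w₃ ≤ N →
            (∀ {y} → w₁ < y → y ≤ N → y ≢ w₂ → y ≢ w₃ → ⊥) → suc w₁ ≡ w₂ × suc w₂ ≡ w₃ × w₃ ≡ N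
top-three {N} {w₁} {w₂} {w₃} w₁<w₂ w₂<w₃ w₃≤N only =
  tight w₁<w₂ (λ w₁<y y<w₂ → only w₁<y (≤-trans (<⇒≤ (<-trans y<w₂ w₂<w₃)) w₃≤N) (<⇒≢ y<w₂) (<⇒≢ (<-trans y<w₂ w₂<w₃))) ,
  tight w₂<w₃ (λ {y} w₂<y y<w₃ → only (<-trans w₁<w₂ w₂<y) (≤-trans (<⇒≤ y<w₃) w₃≤N) (>⇒≢ w₂<y) (<⇒≢ y<w₃)) ,
  top
  where
  tight : ∀ {u v} → u < v → (∀ {y} → u < y → y < v → ⊥) → suc u ≡ v
  tight {u} u<v none with m≤n⇒m<n∨m≡n u<v
  ... | inj₁ 1+u<v = ⊥-elim (none (n<1+n u) 1+u<v)
  ... | inj₂ 1+u≡v = 1+u≡v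
  top : w₃ ≡ N
  top with m≤n⇒m<n∨m≡n w₃≤N
  ... | inj₁ w₃<N = ⊥-elim (only (<-trans w₁<w₂ (<-trans w₂<w₃ w₃<N)) ≤-refl (>⇒≢ (<-trans w₂<w₃ w₃<N)) (>⇒≢ w₃<N))
  ... | inj₂ w₃≡N = w₃≡N

boxEmpty-unit-gap : ∀ π I V {a b} → nth V (suc (suc b)) ≡ suc (nth V (suc b)) → boxEmpty π I V (a , b) ≡ true
boxEmpty-unit-gap π I V {a} {b} unit = cong not (anyB-false (range1 (length π)) λ {m} _ →
  trans (cong (λ c → left m ∧ right m ∧ (nth V (suc b) <ᵇ nth π m) ∧ (nth π m <ᵇ c)) unit)
  (trans (cong (λ c → left m ∧ right m ∧ c) (<ᵇ-∧-<ᵇ-suc (nth V (suc b)) (nth π m)))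
  (trans (cong (left m ∧_) (∧-zeroʳ (right m))) (∧-zeroʳ (left m)))))
  where
  left right : ℕ → Bool
  left m  = nth I (suc a) <ᵇ m
  right m = m <ᵇ nth I (suc (suc a))

topValues-sound : ∀ {N u v w} → (suc (suc u) ≡ᵇ N) ∧ (suc v ≡ᵇ N) ∧ (w ≡ᵇ N) ≡ true → suc (suc u) ≡ N × suc v ≡ N × w ≡ N
topValues-sound {N} {u} {v} top with ∧-true⁻ {suc (suc u) ≡ᵇ N} top
... | e₁ , e₂₃ with ∧-true⁻ {suc v ≡ᵇ N} e₂₃
...   | e₂ , e₃ = ≡ᵇ-sound e₁ , ≡ᵇ-sound e₂ , ≡ᵇ-sound e₃

topValues⇒increasing : ∀ {N u v w} → (suc (suc u) ≡ᵇ N) ∧ (suc v ≡ᵇ N) ∧ (w ≡ᵇ N) ≡ true → u < v × v < w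
topValues⇒increasing {N} {u} {v} {w} top with topValues-sound {N} {u} {v} {w} top
... | e₁ , e₂ , e₃ = ≤-reflexive (suc-injective (trans e₁ (sym e₂))) , ≤-reflexive (trans e₂ (sym e₃))

R₂-boxes-top : ∀ {N w₁ w₂ w₃} π I → length π ≡ N → suc (suc w₁) ≡ N → suc w₂ ≡ N → w₃ ≡ N →
  allB (boxEmpty π I (0 ∷ w₁ ∷ w₂ ∷ w₃ ∷ suc (length π) ∷ [])) R₂ ≡ true
R₂-boxes-top {w₁ = w₁} {w₂} {w₃} π I len e₁ e₂ e₃ = allB-true⁺ {p = boxEmpty π I V} R₂ λ { {a , b} box∈ →
  boxEmpty-unit-gap π I V {a} {b} (unit-gap (proj₂ (∈-square⁻ (1 ∷ 2 ∷ 3 ∷ []) box∈))) }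
  where
  V = 0 ∷ w₁ ∷ w₂ ∷ w₃ ∷ suc (length π) ∷ []
  unit-gap : ∀ {b} → b ∈ (1 ∷ 2 ∷ 3 ∷ []) → nth V (suc (suc b)) ≡ suc (nth V (suc b))
  unit-gap (here refl)                 = suc-injective (trans e₂ (sym e₁))
  unit-gap (there (here refl))         = trans e₃ (sym e₂)
  unit-gap (there (there (here refl))) = cong suc (trans len (sym e₃))

module _ {N π J K w₁ w₂ w₃} (P : Perm N π) (1<J : 1 < J) (J<K : J < K) (K≤N : K ≤ N)
         (w₁<w₂ : w₁ < w₂) (w₂<w₃ : w₂ < w₃) (πJ : nth π J ≡ w₂)
         (ends : (nth π 1 ≡ w₁ × nth π K ≡ w₃) ⊎ (nth π 1 ≡ w₃ × nth π K ≡ w₁)) where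

  private
    I = 0 ∷ 1 ∷ J ∷ K ∷ suc (length π) ∷ []
    V = 0 ∷ w₁ ∷ w₂ ∷ w₃ ∷ suc (length π) ∷ []

    ≤-length : ∀ {m} → m ≤ N → m ≤ length π
    ≤-length = subst (_ ≤_) (sym (perm-length P))

    entry≤N : ∀ {m} → 1 ≤ m → m ≤ N → nth π m ≤ N
    entry≤N 1≤m m≤N = proj₂ (perm-∈ P (nth-∈ π 1≤m (≤-length m≤N)))

    w₃≤N : w₃ ≤ N
    w₃≤N = case ends of λ where
      (inj₁ (_ , πK)) → subst (_≤ N) πK (entry≤N (<⇒≤ (<-trans 1<J J<K)) K≤N)
      (inj₂ (π1 , _)) → subst (_≤ N) π1 (entry≤N ≤-refl (≤-trans (<⇒≤ (<-trans 1<J J<K)) K≤N))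

    ends-≢ : ∀ {y} → w₁ < y → y ≢ w₃ → nth π 1 ≢ y × nth π K ≢ y
    ends-≢ w₁<y y≢w₃ = case ends of λ where
      (inj₁ (π1 , πK)) → (λ e → <⇒≢ w₁<y (trans (sym π1) e)) , (λ e → y≢w₃ (trans (sym e) πK))
      (inj₂ (π1 , πK)) → (λ e → y≢w₃ (trans (sym e) π1)) , (λ e → <⇒≢ w₁<y (trans (sym πK) e))

    -- The boxes of R₂ cover every point right of position 1 and above w₁.
    R₂-box-occupied : ∀ {y} → w₁ < y → y ≤ N → y ≢ w₂ → y ≢ w₃ → allB (boxEmpty π I V) R₂ ≡ false
    R₂-box-occupied {y} w₁<y y≤N y≢w₂ y≢w₃ with ∈-nth π (perm-∋ P (≤-trans (s≤s z≤n) w₁<y) y≤N)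
    ... | m , 1≤m , m≤ , πm≡y with m ≟ 1 | m ≟ J | m ≟ K
    ... | yes refl | _        | _        = ⊥-elim (proj₁ (ends-≢ w₁<y y≢w₃) πm≡y)
    ... | no _     | yes refl | _        = ⊥-elim (y≢w₂ (trans (sym πm≡y) πJ))
    ... | no _     | no _     | yes refl = ⊥-elim (proj₂ (ends-≢ w₁<y y≢w₃) πm≡y)
    ... | no m≢1   | no m≢J   | no m≢K
      with three-gaps 1<J J<K (s≤s (≤-length K≤N)) (≤∧≢⇒< 1≤m (m≢1 ∘ sym)) (s≤s m≤) m≢J m≢K
         | three-gaps w₁<w₂ w₂<w₃ (s≤s (≤-length w₃≤N)) w₁<y (s≤s (≤-length y≤N)) y≢w₂ y≢w₃
    ... | a , a∈ , Ia<m , m<Ia′ | b , b∈ , Vb<y , y<Vb′ =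
      allB-false {p = boxEmpty π I V} (∈-square⁺ a∈ b∈) (cong not (anyB-true {p = inBox π I V (a , b)} (∈-range1⁺ 1≤m m≤) in-box))
      where
      in-box : inBox π I V (a , b) m ≡ true
      in-box = ∧-true⁺ (<ᵇ-true Ia<m) (∧-true⁺ (<ᵇ-true m<Ia′)
                 (∧-true⁺ (<ᵇ-true (subst (_ <_) (sym πm≡y) Vb<y)) (<ᵇ-true (subst (_< _) (sym πm≡y) y<Vb′))))

  R₂-boxes-anchored : allB (boxEmpty π (0 ∷ 1 ∷ J ∷ K ∷ suc (length π) ∷ []) (0 ∷ w₁ ∷ w₂ ∷ w₃ ∷ suc (length π) ∷ [])) R₂
                        ≡ (suc (suc w₁) ≡ᵇ N) ∧ (suc w₂ ≡ᵇ N) ∧ (w₃ ≡ᵇ N)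
  R₂-boxes-anchored = bool-ext only-top-three
    (λ top → let e₁ , e₂ , e₃ = topValues-sound {N} {w₁} {w₂} {w₃} top in R₂-boxes-top π I (perm-length P) e₁ e₂ e₃)
    where
    only-top-three : allB (boxEmpty π I V) R₂ ≡ true → (suc (suc w₁) ≡ᵇ N) ∧ (suc w₂ ≡ᵇ N) ∧ (w₃ ≡ᵇ N) ≡ true
    only-top-three empty with top-three w₁<w₂ w₂<w₃ w₃≤N (λ w₁<y y≤N y≢w₂ y≢w₃ →
                                case trans (sym empty) (R₂-box-occupied w₁<y y≤N y≢w₂ y≢w₃) of λ ())
    ... | 1+w₁≡w₂ , 1+w₂≡w₃ , w₃≡N = ∧-true⁺ (≡ᵇ-true (trans (cong suc 1+w₁≡w₂) (trans 1+w₂≡w₃ w₃≡N)))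
                                       (∧-true⁺ (≡ᵇ-true (trans 1+w₂≡w₃ w₃≡N)) (≡ᵇ-true w₃≡N))

isOccurrence₁₂₃-anchored : ∀ {N π J K} → Perm N π → 1 < J → J < K → K ≤ N →
  isOccurrence (mesh p123 R₂) π (1 ∷ J ∷ K ∷ []) ≡ (suc (suc (nth π 1)) ≡ᵇ N) ∧ (suc (nth π J) ≡ᵇ N) ∧ (nth π K ≡ᵇ N)
isOccurrence₁₂₃-anchored {N} {π} {J} {K} P 1<J J<K K≤N = begin
  isOccurrence (mesh p123 R₂) π (1 ∷ J ∷ K ∷ [])         ≡⟨ cong (_∧ boxes (sort (u ∷ v ∷ w ∷ []))) (orderIso-123 π 1 J K) ⟩
  ((u <ᵇ v) ∧ (v <ᵇ w)) ∧ boxes (sort (u ∷ v ∷ w ∷ []))  ≡⟨ ∧-cong-if ((u <ᵇ v) ∧ (v <ᵇ w)) sorted ⟩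
  ((u <ᵇ v) ∧ (v <ᵇ w)) ∧ top                            ≡⟨ ∧-absorb {(u <ᵇ v) ∧ (v <ᵇ w)} top increasing ⟩
  top                                                    ∎
  where
  open ≡-Reasoning
  u = nth π 1 ; v = nth π J ; w = nth π K
  boxes : List ℕ → Bool
  boxes S = allB (boxEmpty π (0 ∷ 1 ∷ J ∷ K ∷ suc (length π) ∷ []) (0 ∷ S ++ [ suc (length π) ])) R₂
  top = (suc (suc u) ≡ᵇ N) ∧ (suc v ≡ᵇ N) ∧ (w ≡ᵇ N)
  increasing : top ≡ true → (u <ᵇ v) ∧ (v <ᵇ w) ≡ true
  increasing t = let u<v , v<w = topValues⇒increasing {N} {u} {v} {w} t in ∧-true⁺ (<ᵇ-true u<v) (<ᵇ-true v<w)
  sorted : (u <ᵇ v) ∧ (v <ᵇ w) ≡ true → boxes (sort (u ∷ v ∷ w ∷ [])) ≡ top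
  sorted uvw = trans (cong boxes (sort-increasing u<v v<w)) (R₂-boxes-anchored P 1<J J<K K≤N u<v v<w refl (inj₁ (refl , refl)))
    where
    u<v = <ᵇ-sound (proj₁ (∧-true⁻ {u <ᵇ v} uvw))
    v<w = <ᵇ-sound (proj₂ (∧-true⁻ {u <ᵇ v} uvw))

isOccurrence₃₂₁-anchored : ∀ {N π J K} → Perm N π → 1 < J → J < K → K ≤ N →
  isOccurrence (mesh p321 R₂) π (1 ∷ J ∷ K ∷ []) ≡ (nth π 1 ≡ᵇ N) ∧ (suc (nth π J) ≡ᵇ N) ∧ (suc (suc (nth π K)) ≡ᵇ N)
isOccurrence₃₂₁-anchored {N} {π} {J} {K} P 1<J J<K K≤N = begin
  isOccurrence (mesh p321 R₂) π (1 ∷ J ∷ K ∷ [])         ≡⟨ cong (_∧ boxes (sort (u ∷ v ∷ w ∷ []))) (orderIso-321 π 1 J K) ⟩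
  ((v <ᵇ u) ∧ (w <ᵇ v)) ∧ boxes (sort (u ∷ v ∷ w ∷ []))  ≡⟨ ∧-cong-if ((v <ᵇ u) ∧ (w <ᵇ v)) sorted ⟩
  ((v <ᵇ u) ∧ (w <ᵇ v)) ∧ top                            ≡⟨ ∧-absorb {(v <ᵇ u) ∧ (w <ᵇ v)} top decreasing ⟩
  top                                                    ≡⟨ ∧-reverse (suc (suc w) ≡ᵇ N) (suc v ≡ᵇ N) (u ≡ᵇ N) ⟩
  (u ≡ᵇ N) ∧ (suc v ≡ᵇ N) ∧ (suc (suc w) ≡ᵇ N)           ∎
  where
  open ≡-Reasoning
  u = nth π 1 ; v = nth π J ; w = nth π K
  boxes : List ℕ → Bool
  boxes S = allB (boxEmpty π (0 ∷ 1 ∷ J ∷ K ∷ suc (length π) ∷ []) (0 ∷ S ++ [ suc (length π) ])) R₂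
  top = (suc (suc w) ≡ᵇ N) ∧ (suc v ≡ᵇ N) ∧ (u ≡ᵇ N)
  decreasing : top ≡ true → (v <ᵇ u) ∧ (w <ᵇ v) ≡ true
  decreasing t = let w<v , v<u = topValues⇒increasing {N} {w} {v} {u} t in ∧-true⁺ (<ᵇ-true v<u) (<ᵇ-true w<v)
  sorted : (v <ᵇ u) ∧ (w <ᵇ v) ≡ true → boxes (sort (u ∷ v ∷ w ∷ [])) ≡ top
  sorted vuw = trans (cong boxes (sort-decreasing w<v v<u)) (R₂-boxes-anchored P 1<J J<K K≤N w<v v<u refl (inj₂ (refl , refl)))
    where
    v<u = <ᵇ-sound (proj₁ (∧-true⁻ {v <ᵇ u} vuw))
    w<v = <ᵇ-sound (proj₂ (∧-true⁻ {v <ᵇ u} vuw))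

topValues₁₂₃-⊳ : ∀ n r y z → r ≤ n →
  (suc (suc (suc n ∸ r)) ≡ᵇ suc n) ∧ (suc (bump (suc n ∸ r) y) ≡ᵇ suc n) ∧ (bump (suc n ∸ r) z ≡ᵇ suc n)
    ≡ (r ≡ᵇ 2) ∧ (y ≡ᵇ pred n) ∧ (z ≡ᵇ n)
topValues₁₂₃-⊳ n                  zero                _ _ _ = false-∧ (≡ᵇ-false (>⇒≢ (m<n⇒m<1+n (n<1+n n))))
topValues₁₂₃-⊳ n                  (suc zero)          _ _ _ = false-∧ (≡ᵇ-false (>⇒≢ (n<1+n n)))
topValues₁₂₃-⊳ (suc zero)         (suc (suc zero))    _ _ (s≤s ())
topValues₁₂₃-⊳ (suc (suc m))      (suc (suc zero))    y z _ =
  cong₂ _∧_ (≡ᵇ-true {m} refl) (cong₂ _∧_ (bump-≡ᵇ-suc y ≤-refl) (bump-≡ᵇ-suc z (n≤1+n _)))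
topValues₁₂₃-⊳ (suc (suc (suc m))) (suc (suc (suc r))) _ _ (s≤s (s≤s (s≤s r≤m))) =
  false-∧ (≡ᵇ-false (<⇒≢ (s≤s (m∸n≤m (suc m) r))))

topValues₃₂₁-⊳ : ∀ n r y z → 1 ≤ n → y ≤ n → z ≤ n →
  (suc n ∸ r ≡ᵇ suc n) ∧ (suc (bump (suc n ∸ r) y) ≡ᵇ suc n) ∧ (suc (suc (bump (suc n ∸ r) z)) ≡ᵇ suc n)
    ≡ (r ≡ᵇ 0) ∧ (y ≡ᵇ n) ∧ (z ≡ᵇ pred n)
topValues₃₂₁-⊳ (suc m) zero    y z _ y≤ z≤ =
  cong₂ _∧_ (≡ᵇ-true {m} refl) (cong₂ _∧_ (cong (λ u → suc u ≡ᵇ suc (suc m)) (bump-< (s≤s y≤)))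
                                          (cong (λ u → suc (suc u) ≡ᵇ suc (suc m)) (bump-< (s≤s z≤))))
topValues₃₂₁-⊳ n       (suc r) _ _ _ _  _  = false-∧ (≡ᵇ-false (<⇒≢ (s≤s (m∸n≤m n r))))

anchoredOcc-before : ∀ {n σ a b c} p π → Perm n σ →
  (∀ {j k} → 1 ≤ j → k ≤ n → j < k → isOccurrence p π (1 ∷ suc j ∷ suc k ∷ []) ≡ c ∧ ((nth σ j ≡ᵇ a) ∧ (nth σ k ≡ᵇ b))) →
  anchoredOcc p π n ≡ ⟦ c ⟧ * before a b σ
anchoredOcc-before {n} {σ} {a} {b} {c} p π P values = begin
  ∑ S (λ j → ∑ S λ k → ⟦ occurs p π 1 (suc j) (suc k) ⟧)  ≡⟨ ∑-cong S (λ j∈ → ∑-cong S (λ k∈ → entry j∈ k∈)) ⟩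
  ∑ S (λ j → ∑ S λ k → ⟦ c ⟧ * G j k)                     ≡⟨ ∑-cong S (λ {j} _ → ∑-*ˡ S ⟦ c ⟧ (G j)) ⟩
  ∑ S (λ j → ⟦ c ⟧ * ∑ S (G j))                           ≡⟨ ∑-*ˡ S ⟦ c ⟧ _ ⟩
  ⟦ c ⟧ * ∑ S (λ j → ∑ S (G j))                           ≡⟨ cong (λ m → ⟦ c ⟧ * ∑ (range1 m) (λ j → ∑ (range1 m) (G j))) (sym (perm-length P)) ⟩
  ⟦ c ⟧ * ∑ (positions σ) (λ j → ∑ (positions σ) (G j))   ≡⟨ cong (⟦ c ⟧ *_) (before-positions a b σ) ⟩
  ⟦ c ⟧ * before a b σ                                    ∎
  where
  open ≡-Reasoning
  S = range1 n
  G : ℕ → ℕ → ℕ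
  G j k = ⟦ j <ᵇ k ⟧ * (⟦ nth σ j ≡ᵇ a ⟧ * ⟦ nth σ k ≡ᵇ b ⟧)
  entry : ∀ {j k} → j ∈ S → k ∈ S → ⟦ occurs p π 1 (suc j) (suc k) ⟧ ≡ ⟦ c ⟧ * G j k
  entry {zero}  j∈ _  = case proj₁ (∈-range1⁻ j∈) of λ ()
  entry {suc j} {k} j∈ k∈ = trans (cong ⟦_⟧ (begin
    ((suc j <ᵇ k) ∧ true) ∧ isOcc                                 ≡⟨ cong (_∧ isOcc) (∧-identityʳ (suc j <ᵇ k)) ⟩
    (suc j <ᵇ k) ∧ isOcc                                          ≡⟨ ∧-cong-if (suc j <ᵇ k) (values (s≤s z≤n) (proj₂ (∈-range1⁻ k∈)) ∘ <ᵇ-sound) ⟩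
    (suc j <ᵇ k) ∧ (c ∧ ((nth σ (suc j) ≡ᵇ a) ∧ (nth σ k ≡ᵇ b)))  ≡⟨ ∧-left-comm (suc j <ᵇ k) c _ ⟩
    c ∧ ((suc j <ᵇ k) ∧ ((nth σ (suc j) ≡ᵇ a) ∧ (nth σ k ≡ᵇ b)))  ∎))
    (⟦⟧-∧³ c (suc j <ᵇ k) (nth σ (suc j) ≡ᵇ a) (nth σ k ≡ᵇ b))
    where isOcc = isOccurrence p π (1 ∷ suc (suc j) ∷ suc k ∷ [])

module _ {n r σ} (P : Perm n σ) (r≤n : r ≤ n) where

  private
    x = suc n ∸ r
    1≤x : 1 ≤ x
    1≤x = proj₁ (⊳-head-bounds n r r≤n)
    Pπ : Perm (suc n) (r ⊳⟨ n ⟩ σ)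
    Pπ = perm-⊳ P r≤n
    entry≤n : ∀ {j} → 1 ≤ j → j ≤ n → nth σ j ≤ n
    entry≤n 1≤j j≤n = proj₂ (perm-∈ P (nth-∈ σ 1≤j (subst (_ ≤_) (sym (perm-length P)) j≤n)))

  anchoredOcc₁₂₃-⊳ : anchoredOcc (mesh p123 R₂) (r ⊳⟨ n ⟩ σ) n ≡ ⟦ r ≡ᵇ 2 ⟧ * topAscent σ
  anchoredOcc₁₂₃-⊳ = trans (anchoredOcc-before {c = r ≡ᵇ 2} (mesh p123 R₂) (r ⊳⟨ n ⟩ σ) P values)
                           (cong (⟦ r ≡ᵇ 2 ⟧ *_) (sym (topAscent-perm P)))
    where
    values : ∀ {j k} → 1 ≤ j → k ≤ n → j < k →
             isOccurrence (mesh p123 R₂) (r ⊳⟨ n ⟩ σ) (1 ∷ suc j ∷ suc k ∷ []) ≡ (r ≡ᵇ 2) ∧ ((nth σ j ≡ᵇ pred n) ∧ (nth σ k ≡ᵇ n))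
    values {j} {k} 1≤j k≤n j<k = begin
      isOccurrence (mesh p123 R₂) (r ⊳⟨ n ⟩ σ) (1 ∷ suc j ∷ suc k ∷ [])
        ≡⟨ isOccurrence₁₂₃-anchored Pπ (s≤s 1≤j) (s≤s j<k) (s≤s k≤n) ⟩
      (suc (suc x) ≡ᵇ suc n) ∧ (suc (nth (r ⊳⟨ n ⟩ σ) (suc j)) ≡ᵇ suc n) ∧ (nth (r ⊳⟨ n ⟩ σ) (suc k) ≡ᵇ suc n)
        ≡⟨ cong₂ (λ u w → (suc (suc x) ≡ᵇ suc n) ∧ (suc u ≡ᵇ suc n) ∧ (w ≡ᵇ suc n))
                 (nth-bump σ 1≤x 1≤j) (nth-bump σ 1≤x (≤-trans 1≤j (<⇒≤ j<k))) ⟩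
      (suc (suc x) ≡ᵇ suc n) ∧ (suc (bump x (nth σ j)) ≡ᵇ suc n) ∧ (bump x (nth σ k) ≡ᵇ suc n)
        ≡⟨ topValues₁₂₃-⊳ n r (nth σ j) (nth σ k) r≤n ⟩
      (r ≡ᵇ 2) ∧ (nth σ j ≡ᵇ pred n) ∧ (nth σ k ≡ᵇ n) ∎
      where open ≡-Reasoning

  anchoredOcc₃₂₁-⊳ : anchoredOcc (mesh p321 R₂) (r ⊳⟨ n ⟩ σ) n ≡ ⟦ r ≡ᵇ 0 ⟧ * topDescent σ
  anchoredOcc₃₂₁-⊳ = trans (anchoredOcc-before {c = r ≡ᵇ 0} (mesh p321 R₂) (r ⊳⟨ n ⟩ σ) P values)
                           (cong (⟦ r ≡ᵇ 0 ⟧ *_) (sym (topDescent-perm P)))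
    where
    values : ∀ {j k} → 1 ≤ j → k ≤ n → j < k →
             isOccurrence (mesh p321 R₂) (r ⊳⟨ n ⟩ σ) (1 ∷ suc j ∷ suc k ∷ []) ≡ (r ≡ᵇ 0) ∧ ((nth σ j ≡ᵇ n) ∧ (nth σ k ≡ᵇ pred n))
    values {j} {k} 1≤j k≤n j<k = begin
      isOccurrence (mesh p321 R₂) (r ⊳⟨ n ⟩ σ) (1 ∷ suc j ∷ suc k ∷ [])
        ≡⟨ isOccurrence₃₂₁-anchored Pπ (s≤s 1≤j) (s≤s j<k) (s≤s k≤n) ⟩
      (x ≡ᵇ suc n) ∧ (suc (nth (r ⊳⟨ n ⟩ σ) (suc j)) ≡ᵇ suc n) ∧ (suc (suc (nth (r ⊳⟨ n ⟩ σ) (suc k))) ≡ᵇ suc n)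
        ≡⟨ cong₂ (λ u w → (x ≡ᵇ suc n) ∧ (suc u ≡ᵇ suc n) ∧ (suc (suc w) ≡ᵇ suc n))
                 (nth-bump σ 1≤x 1≤j) (nth-bump σ 1≤x 1≤k) ⟩
      (x ≡ᵇ suc n) ∧ (suc (bump x (nth σ j)) ≡ᵇ suc n) ∧ (suc (suc (bump x (nth σ k))) ≡ᵇ suc n)
        ≡⟨ topValues₃₂₁-⊳ n r (nth σ j) (nth σ k) (≤-trans 1≤j (≤-trans (<⇒≤ j<k) k≤n))
                     (entry≤n 1≤j (≤-trans (<⇒≤ j<k) k≤n)) (entry≤n 1≤k k≤n) ⟩
      (r ≡ᵇ 0) ∧ (nth σ j ≡ᵇ n) ∧ (nth σ k ≡ᵇ pred n) ∎
      where
      open ≡-Reasoning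
      1≤k = ≤-trans 1≤j (<⇒≤ j<k)

occ-R₂-⊳ : ∀ {a b c n r σ} → Perm n σ → r ≤ n → let p = mesh (a ∷ b ∷ c ∷ []) R₂ in
  occ p (r ⊳⟨ n ⟩ σ) ≡ anchoredOcc p (r ⊳⟨ n ⟩ σ) n + occ p σ
occ-R₂-⊳ {a} {b} {c} {n} {r} {σ} P r≤n =
  trans (occ-R₂-split {a} {b} {c} σ (proj₁ bounds) (subst (λ m → suc n ∸ r ≤ suc m) (sym (perm-length P)) (proj₂ bounds)))
        (cong (λ m → anchoredOcc p (r ⊳⟨ n ⟩ σ) m + occ p σ) (perm-length P))
  where
  p = mesh (a ∷ b ∷ c ∷ []) R₂
  bounds : 1 ≤ suc n ∸ r × suc n ∸ r ≤ suc n
  bounds = ⊳-head-bounds n r r≤n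

occ₁₂₃-⊳ : ∀ {n r σ} → Perm n σ → r ≤ n →
           occ (mesh p123 R₂) (r ⊳⟨ n ⟩ σ) ≡ ⟦ r ≡ᵇ 2 ⟧ * topAscent σ + occ (mesh p123 R₂) σ
occ₁₂₃-⊳ {σ = σ} P r≤n = trans (occ-R₂-⊳ {1} {2} {3} P r≤n) (cong (_+ occ (mesh p123 R₂) σ) (anchoredOcc₁₂₃-⊳ P r≤n))

occ₃₂₁-⊳ : ∀ {n r σ} → Perm n σ → r ≤ n →
           occ (mesh p321 R₂) (r ⊳⟨ n ⟩ σ) ≡ ⟦ r ≡ᵇ 0 ⟧ * topDescent σ + occ (mesh p321 R₂) σ
occ₃₂₁-⊳ {σ = σ} P r≤n = trans (occ-R₂-⊳ {3} {2} {1} P r≤n) (cong (_+ occ (mesh p321 R₂) σ) (anchoredOcc₃₂₁-⊳ P r≤n))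

-- An involution exchanging the statistics for R₂

-- On the depth r of a first entry, a 3-cycle of the depths 0, 1, 2 of the three
-- largest values, run backwards when the flag (ascendingTop of the rest) is false.
cycleTop : Bool → ℕ → ℕ
cycleTop true  0 = 1
cycleTop true  1 = 2
cycleTop true  2 = 0
cycleTop false 0 = 2
cycleTop false 1 = 0
cycleTop false 2 = 1
cycleTop _     r = r

cycleTop-involutive : ∀ s r → cycleTop (not s) (cycleTop s r) ≡ r
cycleTop-involutive true  0 = refl
cycleTop-involutive true  1 = refl
cycleTop-involutive true  2 = refl
cycleTop-involutive false 0 = refl
cycleTop-involutive false 1 = refl
cycleTop-involutive false 2 = refl
cycleTop-involutive true  (suc (suc (suc r))) = refl
cycleTop-involutive false (suc (suc (suc r))) = refl

cycleTop-≤ : ∀ s {r n} → r ≤ suc (suc n) → cycleTop s r ≤ suc (suc n)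
cycleTop-≤ true  {0} _ = s≤s z≤n
cycleTop-≤ true  {1} _ = s≤s (s≤s z≤n)
cycleTop-≤ true  {2} _ = z≤n
cycleTop-≤ false {0} _ = s≤s (s≤s z≤n)
cycleTop-≤ false {1} _ = z≤n
cycleTop-≤ false {2} _ = s≤s z≤n
cycleTop-≤ true  {suc (suc (suc r))} r≤ = r≤
cycleTop-≤ false {suc (suc (suc r))} r≤ = r≤

cycleTop-ascent : ∀ s r → ⟦ cycleTop s r ≡ᵇ 1 ⟧ + ⟦ 1 <ᵇ cycleTop s r ⟧ * ⟦ not s ⟧ ≡ ⟦ r ≡ᵇ 0 ⟧ + ⟦ 1 <ᵇ r ⟧ * ⟦ not s ⟧
cycleTop-ascent true  0 = refl
cycleTop-ascent true  1 = refl
cycleTop-ascent true  2 = refl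
cycleTop-ascent false 0 = refl
cycleTop-ascent false 1 = refl
cycleTop-ascent false 2 = refl
cycleTop-ascent true  (suc (suc (suc r))) = refl
cycleTop-ascent false (suc (suc (suc r))) = refl

cycleTop-123 : ∀ s r → ⟦ cycleTop s r ≡ᵇ 2 ⟧ * ⟦ not s ⟧ ≡ ⟦ r ≡ᵇ 0 ⟧ * ⟦ not s ⟧
cycleTop-123 true  r = trans (*-zeroʳ ⟦ cycleTop true r ≡ᵇ 2 ⟧) (sym (*-zeroʳ ⟦ r ≡ᵇ 0 ⟧))
cycleTop-123 false 0 = refl
cycleTop-123 false 1 = refl
cycleTop-123 false 2 = refl
cycleTop-123 false (suc (suc (suc r))) = refl

cycleTop-321 : ∀ s r → ⟦ cycleTop s r ≡ᵇ 0 ⟧ * ⟦ s ⟧ ≡ ⟦ r ≡ᵇ 2 ⟧ * ⟦ s ⟧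
cycleTop-321 false r = trans (*-zeroʳ ⟦ cycleTop false r ≡ᵇ 0 ⟧) (sym (*-zeroʳ ⟦ r ≡ᵇ 2 ⟧))
cycleTop-321 true  0 = refl
cycleTop-321 true  1 = refl
cycleTop-321 true  2 = refl
cycleTop-321 true  (suc (suc (suc r))) = refl

-- Below three entries there are no occurrences, and reversal already exchanges
-- topAscent and topDescent.
Φ : ℕ → List ℕ → List ℕ
Φ (suc (suc (suc n))) (x ∷ τ) = cycleTop (ascendingTop σ) (suc (suc (suc n)) ∸ x) ⊳⟨ suc (suc n) ⟩ Φ (suc (suc n)) σ
  where σ = map (unbump x) τ
Φ _ π = reverse π

Φ-⊳ : ∀ {n r σ} → r ≤ 2 + n → Φ (3 + n) (r ⊳⟨ 2 + n ⟩ σ) ≡ cycleTop (ascendingTop σ) r ⊳⟨ 2 + n ⟩ Φ (2 + n) σ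
Φ-⊳ {n} {r} {σ} r≤ = cong₂ (λ σ′ r′ → cycleTop (ascendingTop σ′) r′ ⊳⟨ 2 + n ⟩ Φ (2 + n) σ′)
                           (unbump-bump-map (3 + n ∸ r) σ) (m∸[m∸n]≡n (m≤n⇒m≤1+n r≤))

Φ-perm : ∀ n {π} → Perm n π → Perm n (Φ n π)
Φ-perm zero {π} P = ↭-trans (↭-reverse π) P
Φ-perm (suc zero) {π} P = ↭-trans (↭-reverse π) P
Φ-perm (suc (suc zero)) {π} P = ↭-trans (↭-reverse π) P
Φ-perm (suc (suc (suc n))) = ⊳-elim (λ π → Perm (3 + n) (Φ (3 + n) π)) λ {r} {σ} r≤ Pσ →
  subst (Perm (3 + n)) (sym (Φ-⊳ r≤)) (perm-⊳ (Φ-perm (suc (suc n)) Pσ) (cycleTop-≤ (ascendingTop σ) r≤))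

Φ-topAscent : ∀ n {π} → Perm n π → topAscent (Φ n π) ≡ topDescent π
Φ-topAscent zero P rewrite perm₀ P = refl
Φ-topAscent (suc zero) P rewrite perm₁ P = refl
Φ-topAscent (suc (suc zero)) P with perm₂ P
... | inj₁ refl = refl
... | inj₂ refl = refl
Φ-topAscent (suc (suc (suc n))) = ⊳-elim (λ π → topAscent (Φ (3 + n) π) ≡ topDescent π) (step (Φ-topAscent (suc (suc n))))
  where
  step : (∀ {σ} → Perm (2 + n) σ → topAscent (Φ (2 + n) σ) ≡ topDescent σ) →
         ∀ {r σ} → r ≤ 2 + n → Perm (2 + n) σ → topAscent (Φ (3 + n) (r ⊳⟨ 2 + n ⟩ σ)) ≡ topDescent (r ⊳⟨ 2 + n ⟩ σ)
  step ih {r} {σ} r≤ Pσ = begin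
    topAscent (Φ (3 + n) (r ⊳⟨ 2 + n ⟩ σ))               ≡⟨ cong topAscent (Φ-⊳ r≤) ⟩
    topAscent (r′ ⊳⟨ 2 + n ⟩ Φ (2 + n) σ)                ≡⟨ topAscent-⊳ (Φ-perm (2 + n) Pσ) (cycleTop-≤ s r≤) ⟩
    ⟦ r′ ≡ᵇ 1 ⟧ + ⟦ 1 <ᵇ r′ ⟧ * topAscent (Φ (2 + n) σ)  ≡⟨ cong (λ u → ⟦ r′ ≡ᵇ 1 ⟧ + ⟦ 1 <ᵇ r′ ⟧ * u) (trans (ih Pσ) d≡) ⟩
    ⟦ r′ ≡ᵇ 1 ⟧ + ⟦ 1 <ᵇ r′ ⟧ * ⟦ not s ⟧                ≡⟨ cycleTop-ascent s r ⟩
    ⟦ r ≡ᵇ 0 ⟧ + ⟦ 1 <ᵇ r ⟧ * ⟦ not s ⟧                  ≡⟨ cong (λ d → ⟦ r ≡ᵇ 0 ⟧ + ⟦ 1 <ᵇ r ⟧ * d) (sym d≡) ⟩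
    ⟦ r ≡ᵇ 0 ⟧ + ⟦ 1 <ᵇ r ⟧ * topDescent σ               ≡⟨ sym (topDescent-⊳ Pσ (s≤s z≤n) r≤) ⟩
    topDescent (r ⊳⟨ 2 + n ⟩ σ)                          ∎
    where
    open ≡-Reasoning
    s = ascendingTop σ
    r′ = cycleTop s r
    d≡ : topDescent σ ≡ ⟦ not s ⟧
    d≡ = proj₂ (orientation Pσ (s≤s (s≤s z≤n)))

Φ-topDescent : ∀ n {π} → Perm n π → 2 ≤ n → topDescent (Φ n π) ≡ topAscent π
Φ-topDescent n {π} P 2≤n = +-cancelˡ-≡ (topDescent π) _ _ (begin
  topDescent π + topDescent (Φ n π)       ≡⟨ cong (_+ topDescent (Φ n π)) (sym (Φ-topAscent n P)) ⟩
  topAscent (Φ n π) + topDescent (Φ n π)  ≡⟨ topAscent+topDescent (Φ-perm n P) 2≤n ⟩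
  1                                       ≡⟨ sym (topAscent+topDescent P 2≤n) ⟩
  topAscent π + topDescent π              ≡⟨ +-comm (topAscent π) (topDescent π) ⟩
  topDescent π + topAscent π              ∎)
  where open ≡-Reasoning

Φ-involutive : ∀ n {π} → Perm n π → Φ n (Φ n π) ≡ π
Φ-involutive zero {π} _ = reverse-involutive π
Φ-involutive (suc zero) {π} _ = reverse-involutive π
Φ-involutive (suc (suc zero)) {π} _ = reverse-involutive π
Φ-involutive (suc (suc (suc n))) = ⊳-elim (λ π → Φ (3 + n) (Φ (3 + n) π) ≡ π) (step (Φ-involutive (suc (suc n))))
  where
  step : (∀ {σ} → Perm (2 + n) σ → Φ (2 + n) (Φ (2 + n) σ) ≡ σ) →
         ∀ {r σ} → r ≤ 2 + n → Perm (2 + n) σ → Φ (3 + n) (Φ (3 + n) (r ⊳⟨ 2 + n ⟩ σ)) ≡ r ⊳⟨ 2 + n ⟩ σ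
  step ih {r} {σ} r≤ Pσ = begin
    Φ (3 + n) (Φ (3 + n) (r ⊳⟨ 2 + n ⟩ σ))                         ≡⟨ cong (Φ (3 + n)) (Φ-⊳ r≤) ⟩
    Φ (3 + n) (cycleTop s r ⊳⟨ 2 + n ⟩ Φ (2 + n) σ)                ≡⟨ Φ-⊳ (cycleTop-≤ s r≤) ⟩
    cycleTop s′ (cycleTop s r) ⊳⟨ 2 + n ⟩ Φ (2 + n) (Φ (2 + n) σ)  ≡⟨ cong₂ (λ r″ σ″ → r″ ⊳⟨ 2 + n ⟩ σ″) flips (ih Pσ) ⟩
    r ⊳⟨ 2 + n ⟩ σ                                                 ∎
    where
    open ≡-Reasoning
    s = ascendingTop σ
    s′ = ascendingTop (Φ (2 + n) σ)
    flips : cycleTop s′ (cycleTop s r) ≡ r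
    flips rewrite Φ-topAscent (2 + n) Pσ | proj₂ (orientation Pσ (s≤s (s≤s z≤n))) | ⟦⟧≡ᵇ1 (not s) = cycleTop-involutive s r

Φ-exchanges : ∀ n {π} → Perm n π → Exchanges (mesh p123 R₂) (mesh p321 R₂) (Φ n) π
Φ-exchanges zero P rewrite perm₀ P = refl , refl
Φ-exchanges (suc zero) P rewrite perm₁ P = refl , refl
Φ-exchanges (suc (suc zero)) P with perm₂ P
... | inj₁ refl = refl , refl
... | inj₂ refl = refl , refl
Φ-exchanges (suc (suc (suc n))) = ⊳-elim (Exchanges (mesh p123 R₂) (mesh p321 R₂) (Φ (3 + n))) (step (Φ-exchanges (suc (suc n))))
  where
  step : (∀ {σ} → Perm (2 + n) σ → Exchanges (mesh p123 R₂) (mesh p321 R₂) (Φ (2 + n)) σ) →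
         ∀ {r σ} → r ≤ 2 + n → Perm (2 + n) σ → Exchanges (mesh p123 R₂) (mesh p321 R₂) (Φ (3 + n)) (r ⊳⟨ 2 + n ⟩ σ)
  step ih {r} {σ} r≤ Pσ = occ₁₂₃-swap , occ₃₂₁-swap
    where
    open ≡-Reasoning
    s = ascendingTop σ
    r′ = cycleTop s r
    Pσ′ : Perm (2 + n) (Φ (2 + n) σ)
    Pσ′ = Φ-perm (2 + n) Pσ
    oriented : topAscent σ ≡ ⟦ s ⟧ × topDescent σ ≡ ⟦ not s ⟧
    oriented = orientation Pσ (s≤s (s≤s z≤n))
    occ₁₂₃-swap : occ (mesh p123 R₂) (Φ (3 + n) (r ⊳⟨ 2 + n ⟩ σ)) ≡ occ (mesh p321 R₂) (r ⊳⟨ 2 + n ⟩ σ)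
    occ₁₂₃-swap = begin
      occ (mesh p123 R₂) (Φ (3 + n) (r ⊳⟨ 2 + n ⟩ σ))
        ≡⟨ cong (occ (mesh p123 R₂)) (Φ-⊳ r≤) ⟩
      occ (mesh p123 R₂) (r′ ⊳⟨ 2 + n ⟩ Φ (2 + n) σ)
        ≡⟨ occ₁₂₃-⊳ Pσ′ (cycleTop-≤ s r≤) ⟩
      ⟦ r′ ≡ᵇ 2 ⟧ * topAscent (Φ (2 + n) σ) + occ (mesh p123 R₂) (Φ (2 + n) σ)
        ≡⟨ cong₂ (λ u o → ⟦ r′ ≡ᵇ 2 ⟧ * u + o) (trans (Φ-topAscent (2 + n) Pσ) (proj₂ oriented)) (proj₁ (ih Pσ)) ⟩
      ⟦ r′ ≡ᵇ 2 ⟧ * ⟦ not s ⟧ + occ (mesh p321 R₂) σ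
        ≡⟨ cong₂ _+_ (cycleTop-123 s r) refl ⟩
      ⟦ r ≡ᵇ 0 ⟧ * ⟦ not s ⟧ + occ (mesh p321 R₂) σ
        ≡⟨ cong (λ d → ⟦ r ≡ᵇ 0 ⟧ * d + occ (mesh p321 R₂) σ) (sym (proj₂ oriented)) ⟩
      ⟦ r ≡ᵇ 0 ⟧ * topDescent σ + occ (mesh p321 R₂) σ
        ≡⟨ sym (occ₃₂₁-⊳ Pσ r≤) ⟩
      occ (mesh p321 R₂) (r ⊳⟨ 2 + n ⟩ σ) ∎
    occ₃₂₁-swap : occ (mesh p321 R₂) (Φ (3 + n) (r ⊳⟨ 2 + n ⟩ σ)) ≡ occ (mesh p123 R₂) (r ⊳⟨ 2 + n ⟩ σ)
    occ₃₂₁-swap = begin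
      occ (mesh p321 R₂) (Φ (3 + n) (r ⊳⟨ 2 + n ⟩ σ))
        ≡⟨ cong (occ (mesh p321 R₂)) (Φ-⊳ r≤) ⟩
      occ (mesh p321 R₂) (r′ ⊳⟨ 2 + n ⟩ Φ (2 + n) σ)
        ≡⟨ occ₃₂₁-⊳ Pσ′ (cycleTop-≤ s r≤) ⟩
      ⟦ r′ ≡ᵇ 0 ⟧ * topDescent (Φ (2 + n) σ) + occ (mesh p321 R₂) (Φ (2 + n) σ)
        ≡⟨ cong₂ (λ d o → ⟦ r′ ≡ᵇ 0 ⟧ * d + o) (trans (Φ-topDescent (2 + n) Pσ (s≤s (s≤s z≤n))) (proj₁ oriented)) (proj₂ (ih Pσ)) ⟩
      ⟦ r′ ≡ᵇ 0 ⟧ * ⟦ s ⟧ + occ (mesh p123 R₂) σ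
        ≡⟨ cong₂ _+_ (cycleTop-321 s r) refl ⟩
      ⟦ r ≡ᵇ 2 ⟧ * ⟦ s ⟧ + occ (mesh p123 R₂) σ
        ≡⟨ cong (λ u → ⟦ r ≡ᵇ 2 ⟧ * u + occ (mesh p123 R₂) σ) (sym (proj₁ oriented)) ⟩
      ⟦ r ≡ᵇ 2 ⟧ * topAscent σ + occ (mesh p123 R₂) σ
        ≡⟨ sym (occ₁₂₃-⊳ Pσ r≤) ⟩
      occ (mesh p123 R₂) (r ⊳⟨ 2 + n ⟩ σ) ∎

Φ-exchanger : Exchanger (mesh p123 R₂) (mesh p321 R₂)
Φ-exchanger = record { exchange = Φ ; perm = Φ-perm ; involutive = Φ-involutive ; exchanges = Φ-exchanges }

-- Rotation by 180°

rc : List ℕ → List ℕ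
rc π = map (suc (length π) ∸_) (reverse π)

length-rc : ∀ π → length (rc π) ≡ length π
length-rc π = trans (length-map _ (reverse π)) (length-reverse π)

module _ {N : ℕ} where

  private
    c : ℕ → ℕ
    c m = suc N ∸ m

  reflect-<ᵇ : ∀ {a b} → a ≤ suc N → b ≤ suc N → (c a <ᵇ c b) ≡ (b <ᵇ a)
  reflect-<ᵇ {a} {b} a≤ b≤ with b <? a
  ... | yes b<a = trans (<ᵇ-true (∸-monoʳ-< b<a a≤)) (sym (<ᵇ-true b<a))
  ... | no  b≮a = trans (<ᵇ-false (≤⇒≯ (∸-monoʳ-≤ (suc N) (≮⇒≥ b≮a)))) (sym (<ᵇ-false b≮a))

  reflect-involutive : ∀ {a} → a ≤ suc N → c (c a) ≡ a
  reflect-involutive = m∸[m∸n]≡n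

  reflect-range1 : map c (range1 N) ↭ range1 N
  reflect-range1 = ↭-trans (↭-reflexive (reflected N)) (↭-reverse (range1 N))
    where
    reflected : ∀ n → map (suc n ∸_) (range1 n) ≡ reverse (range1 n)
    reflected zero    = refl
    reflected (suc n) = begin
      map (suc (suc n) ∸_) (range1 (suc n))              ≡⟨ cong (map (suc (suc n) ∸_)) (range1-suc n) ⟩
      suc n ∷ map (suc (suc n) ∸_) (map suc (range1 n))  ≡⟨ cong (suc n ∷_) (sym (map-∘ (range1 n))) ⟩
      suc n ∷ map (suc n ∸_) (range1 n)                  ≡⟨ cong (suc n ∷_) (reflected n) ⟩
      suc n ∷ reverse (range1 n)                         ≡⟨ sym (reverse-++ (range1 n) [ suc n ]) ⟩
      reverse (range1 n ∷ʳ suc n)                        ≡⟨ cong reverse (sym (range1-∷ʳ n)) ⟩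
      reverse (range1 (suc n))                           ∎
      where open ≡-Reasoning

  ∑-reflect : ∀ f → ∑ (range1 N) f ≡ ∑ (range1 N) (f ∘ c)
  ∑-reflect f = trans (sym (∑-↭ f reflect-range1)) (∑-map c (range1 N) f)

  anyB-reflect : ∀ (p : ℕ → Bool) → anyB p (range1 N) ≡ anyB (p ∘ c) (range1 N)
  anyB-reflect p = trans (sym (anyB-↭ p reflect-range1)) (anyB-map p c (range1 N))

module _ {N π} (P : Perm N π) where

  private
    c : ℕ → ℕ
    c m = suc N ∸ m

    rc≡ : rc π ≡ map c (reverse π)
    rc≡ = cong (λ n → map (suc n ∸_) (reverse π)) (perm-length P)

    entry≤ : All.All (_≤ suc N) π
    entry≤ = All.tabulate (λ y∈ → m≤n⇒m≤1+n (proj₂ (perm-∈ P y∈)))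

  rc-perm : Perm N (rc π)
  rc-perm = ↭-trans (↭-reflexive rc≡) (↭-trans (map⁺ c (↭-trans (↭-reverse π) P)) reflect-range1)

  rc-involutive : rc (rc π) ≡ π
  rc-involutive = begin
    rc (rc π)                            ≡⟨ cong (λ n → map (suc n ∸_) (reverse (rc π))) (trans (length-rc π) (perm-length P)) ⟩
    map c (reverse (rc π))               ≡⟨ cong (map c ∘ reverse) rc≡ ⟩
    map c (reverse (map c (reverse π)))  ≡⟨ cong (map c) (sym (reverse-map c (reverse π))) ⟩
    map c (map c (reverse (reverse π)))  ≡⟨ cong (map c ∘ map c) (reverse-involutive π) ⟩
    map c (map c π)                      ≡⟨ sym (map-∘ π) ⟩
    map (c ∘ c) π                        ≡⟨ map-id-local (All.map reflect-involutive entry≤) ⟩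
    π                                    ∎
    where open ≡-Reasoning

  nth-rc : ∀ {m} → 1 ≤ m → m ≤ N → nth (rc π) (c m) ≡ c (nth π m)
  nth-rc {m} 1≤m m≤N = begin
    nth (rc π) (c m)                  ≡⟨ cong (λ ρ → nth ρ (c m)) rc≡ ⟩
    nth (map c (reverse π)) (c m)     ≡⟨ nth-map-inside c (reverse π) 1≤cm (subst (c m ≤_) (sym (trans (length-reverse π) (perm-length P))) cm≤N) ⟩
    c (nth (reverse π) (c m))         ≡⟨ cong c (nth-reverse π 1≤cm (subst (c m ≤_) (sym (perm-length P)) cm≤N)) ⟩
    c (nth π (suc (length π) ∸ c m))  ≡⟨ cong (λ n → c (nth π (suc n ∸ c m))) (perm-length P) ⟩
    c (nth π (c (c m)))               ≡⟨ cong (c ∘ nth π) (reflect-involutive (m≤n⇒m≤1+n m≤N)) ⟩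
    c (nth π m)                       ∎
    where
    open ≡-Reasoning
    1≤cm = m<n⇒0<n∸m (s≤s m≤N)
    cm≤N = ∸-monoʳ-≤ (suc N) 1≤m

  private
    len-rc : length (rc π) ≡ N
    len-rc = trans (length-rc π) (perm-length P)

    reflected : ∀ {l₁ l₂ l₃ top top′} → top ≡ suc N → top′ ≡ suc N → ∀ {t} → t ≤ 3 →
      nth (0 ∷ c l₃ ∷ c l₂ ∷ c l₁ ∷ top′ ∷ []) (suc t) ≡ c (nth (0 ∷ l₁ ∷ l₂ ∷ l₃ ∷ top ∷ []) (suc (suc (3 ∸ t)))) ×
      nth (0 ∷ c l₃ ∷ c l₂ ∷ c l₁ ∷ top′ ∷ []) (suc (suc t)) ≡ c (nth (0 ∷ l₁ ∷ l₂ ∷ l₃ ∷ top ∷ []) (suc (3 ∸ t)))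
    reflected top≡ top′≡ {0} _ = sym (trans (cong c top≡) (n∸n≡0 N)) , refl
    reflected top≡ top′≡ {1} _ = refl , refl
    reflected top≡ top′≡ {2} _ = refl , refl
    reflected top≡ top′≡ {3} _ = refl , top′≡
    reflected _    _     {suc (suc (suc (suc _)))} (s≤s (s≤s (s≤s ())))

  boxEmpty-rc : ∀ {i₁ i₂ i₃ v₁ v₂ v₃} → All.All (_≤ suc N) (i₁ ∷ i₂ ∷ i₃ ∷ v₁ ∷ v₂ ∷ v₃ ∷ []) → ∀ {a b} → a ≤ 3 → b ≤ 3 →
    boxEmpty (rc π) (0 ∷ c i₃ ∷ c i₂ ∷ c i₁ ∷ suc (length (rc π)) ∷ []) (0 ∷ c v₃ ∷ c v₂ ∷ c v₁ ∷ suc (length (rc π)) ∷ []) (a , b)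
      ≡ boxEmpty π (0 ∷ i₁ ∷ i₂ ∷ i₃ ∷ suc (length π) ∷ []) (0 ∷ v₁ ∷ v₂ ∷ v₃ ∷ suc (length π) ∷ []) (3 ∸ a , 3 ∸ b)
  boxEmpty-rc {i₁} {i₂} {i₃} {v₁} {v₂} {v₃} (i₁≤ All.∷ i₂≤ All.∷ i₃≤ All.∷ v₁≤ All.∷ v₂≤ All.∷ v₃≤ All.∷ All.[]) {a} {b} a≤3 b≤3 =
    cong not (begin
      anyB (inBox (rc π) I′ V′ (a , b)) (range1 (length (rc π)))  ≡⟨ cong (λ n → anyB (inBox (rc π) I′ V′ (a , b)) (range1 n)) len-rc ⟩
      anyB (inBox (rc π) I′ V′ (a , b)) (range1 N)                ≡⟨ anyB-reflect {N} (inBox (rc π) I′ V′ (a , b)) ⟩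
      anyB (inBox (rc π) I′ V′ (a , b) ∘ c) (range1 N)            ≡⟨ anyB-cong (range1 N) (λ m∈ → pointwise (∈-range1⁻ m∈)) ⟩
      anyB (inBox π I V (3 ∸ a , 3 ∸ b)) (range1 N)               ≡⟨ cong (λ n → anyB (inBox π I V (3 ∸ a , 3 ∸ b)) (range1 n)) (sym (perm-length P)) ⟩
      anyB (inBox π I V (3 ∸ a , 3 ∸ b)) (range1 (length π))      ∎)
    where
    open ≡-Reasoning
    I′ = 0 ∷ c i₃ ∷ c i₂ ∷ c i₁ ∷ suc (length (rc π)) ∷ []
    V′ = 0 ∷ c v₃ ∷ c v₂ ∷ c v₁ ∷ suc (length (rc π)) ∷ []
    I = 0 ∷ i₁ ∷ i₂ ∷ i₃ ∷ suc (length π) ∷ []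
    V = 0 ∷ v₁ ∷ v₂ ∷ v₃ ∷ suc (length π) ∷ []
    top≡ : suc (length π) ≡ suc N
    top≡ = cong suc (perm-length P)
    top′≡ : suc (length (rc π)) ≡ suc N
    top′≡ = cong suc len-rc
    I≤ : ∀ s → nth I s ≤ suc N
    V≤ : ∀ s → nth V s ≤ suc N
    I≤ = nth-bounded I (z≤n All.∷ i₁≤ All.∷ i₂≤ All.∷ i₃≤ All.∷ ≤-reflexive top≡ All.∷ All.[])
    V≤ = nth-bounded V (z≤n All.∷ v₁≤ All.∷ v₂≤ All.∷ v₃≤ All.∷ ≤-reflexive top≡ All.∷ All.[])
    column = reflected {i₁} {i₂} {i₃} top≡ top′≡ a≤3
    row = reflected {v₁} {v₂} {v₃} top≡ top′≡ b≤3
    pointwise : ∀ {m} → 1 ≤ m × m ≤ N → inBox (rc π) I′ V′ (a , b) (c m) ≡ inBox π I V (3 ∸ a , 3 ∸ b) m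
    pointwise {m} (1≤m , m≤N) = begin
      inBox (rc π) I′ V′ (a , b) (c m)
        ≡⟨ cong₂ _∧_ (trans (cong (_<ᵇ c m) (proj₁ column)) (reflect-<ᵇ {N} (I≤ (suc (suc a′))) m≤))
          (cong₂ _∧_ (trans (cong (c m <ᵇ_) (proj₂ column)) (reflect-<ᵇ {N} m≤ (I≤ (suc a′))))
          (cong₂ _∧_ (trans (cong₂ _<ᵇ_ (proj₁ row) (nth-rc 1≤m m≤N)) (reflect-<ᵇ {N} (V≤ (suc (suc b′))) πm≤))
                     (trans (cong₂ _<ᵇ_ (nth-rc 1≤m m≤N) (proj₂ row)) (reflect-<ᵇ {N} πm≤ (V≤ (suc b′)))))) ⟩
      (m <ᵇ nth I (suc (suc a′))) ∧ (nth I (suc a′) <ᵇ m) ∧ (nth π m <ᵇ nth V (suc (suc b′))) ∧ (nth V (suc b′) <ᵇ nth π m)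
        ≡⟨ ∧-pair-swap (nth I (suc a′) <ᵇ m) (m <ᵇ nth I (suc (suc a′))) (nth V (suc b′) <ᵇ nth π m) (nth π m <ᵇ nth V (suc (suc b′))) ⟩
      inBox π I V (a′ , b′) m  ∎
      where
      a′ = 3 ∸ a
      b′ = 3 ∸ b
      m≤ = m≤n⇒m≤1+n m≤N
      πm≤ = nth-bounded π entry≤ m

  boxes-rc : ∀ {i₁ i₂ i₃ v₁ v₂ v₃} → All.All (_≤ suc N) (i₁ ∷ i₂ ∷ i₃ ∷ v₁ ∷ v₂ ∷ v₃ ∷ []) →
    allB (boxEmpty (rc π) (0 ∷ c i₃ ∷ c i₂ ∷ c i₁ ∷ suc (length (rc π)) ∷ []) (0 ∷ c v₃ ∷ c v₂ ∷ c v₁ ∷ suc (length (rc π)) ∷ [])) R₂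
      ≡ allB (boxEmpty π (0 ∷ i₁ ∷ i₂ ∷ i₃ ∷ suc (length π) ∷ []) (0 ∷ v₁ ∷ v₂ ∷ v₃ ∷ suc (length π) ∷ [])) R₁
  boxes-rc {i₁} {i₂} {i₃} {v₁} {v₂} {v₃} bounds = begin
    allB (boxEmpty (rc π) I′ V′) R₂                           ≡⟨ allB-cong R₂ (λ { {a , b} box∈ → boxEmpty-rc bounds (≤3 (proj₁ (∈-square⁻ _ box∈))) (≤3 (proj₂ (∈-square⁻ _ box∈))) }) ⟩
    allB (λ { (a , b) → boxEmpty π I V (3 ∸ a , 3 ∸ b) }) R₂  ≡⟨ sym (allB-map (boxEmpty π I V) (λ { (a , b) → 3 ∸ a , 3 ∸ b }) R₂) ⟩
    allB (boxEmpty π I V) (reverse R₁)                        ≡⟨ allB-↭ (boxEmpty π I V) (↭-reverse R₁) ⟩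
    allB (boxEmpty π I V) R₁                                  ∎
    where
    open ≡-Reasoning
    I′ = 0 ∷ c i₃ ∷ c i₂ ∷ c i₁ ∷ suc (length (rc π)) ∷ []
    V′ = 0 ∷ c v₃ ∷ c v₂ ∷ c v₁ ∷ suc (length (rc π)) ∷ []
    I = 0 ∷ i₁ ∷ i₂ ∷ i₃ ∷ suc (length π) ∷ []
    V = 0 ∷ v₁ ∷ v₂ ∷ v₃ ∷ suc (length π) ∷ []
    ≤3 = ∈-123⇒≤3

  private
    SortReflected : ℕ → ℕ → ℕ → Set
    SortReflected i j k = ∃[ v₁ ] ∃[ v₂ ] ∃[ v₃ ]
      (sort (nth π i ∷ nth π j ∷ nth π k ∷ []) ≡ v₁ ∷ v₂ ∷ v₃ ∷ [] ×
       sort (nth (rc π) (c k) ∷ nth (rc π) (c j) ∷ nth (rc π) (c i) ∷ []) ≡ c v₃ ∷ c v₂ ∷ c v₁ ∷ [] ×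
       All.All (_≤ suc N) (v₁ ∷ v₂ ∷ v₃ ∷ []))

    occurs-rc : ∀ τ {i j k} → i ∈ range1 N → j ∈ range1 N → k ∈ range1 N →
      orderIso τ (rc π) (c k ∷ c j ∷ c i ∷ []) ≡ orderIso τ π (i ∷ j ∷ k ∷ []) →
      (orderIso τ π (i ∷ j ∷ k ∷ []) ≡ true → SortReflected i j k) →
      occurs (mesh τ R₂) (rc π) (c k) (c j) (c i) ≡ occurs (mesh τ R₁) π i j k
    occurs-rc τ {i} {j} {k} i∈ j∈ k∈ orderIso≡ sorted =
      cong₂ _∧_ increasing (trans (cong (_∧ boxes′ (sort values′)) orderIso≡) (∧-cong-if (orderIso τ π (i ∷ j ∷ k ∷ [])) boxes≡))
      where
      ≤N+1 : ∀ {m} → m ∈ range1 N → m ≤ suc N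
      ≤N+1 = m≤n⇒m≤1+n ∘ proj₂ ∘ ∈-range1⁻
      values′ = nth (rc π) (c k) ∷ nth (rc π) (c j) ∷ nth (rc π) (c i) ∷ []
      boxes′ : List ℕ → Bool
      boxes′ S = allB (boxEmpty (rc π) (0 ∷ c k ∷ c j ∷ c i ∷ suc (length (rc π)) ∷ []) (0 ∷ S ++ [ suc (length (rc π)) ])) R₂
      boxes : List ℕ → Bool
      boxes S = allB (boxEmpty π (0 ∷ i ∷ j ∷ k ∷ suc (length π) ∷ []) (0 ∷ S ++ [ suc (length π) ])) R₁
      increasing : strictlyIncreasing (c k ∷ c j ∷ c i ∷ []) ≡ strictlyIncreasing (i ∷ j ∷ k ∷ [])
      increasing = trans (cong₂ (λ u v → u ∧ (v ∧ true)) (reflect-<ᵇ {N} (≤N+1 k∈) (≤N+1 j∈)) (reflect-<ᵇ {N} (≤N+1 j∈) (≤N+1 i∈)))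
                         (∧-left-comm (j <ᵇ k) (i <ᵇ j) true)
      boxes≡ : orderIso τ π (i ∷ j ∷ k ∷ []) ≡ true → boxes′ (sort values′) ≡ boxes (sort (nth π i ∷ nth π j ∷ nth π k ∷ []))
      boxes≡ oi with sorted oi
      ... | v₁ , v₂ , v₃ , sort≡ , sort′≡ , v≤ =
        trans (cong boxes′ sort′≡) (trans (boxes-rc (≤N+1 i∈ All.∷ ≤N+1 j∈ All.∷ ≤N+1 k∈ All.∷ v≤)) (cong boxes (sym sort≡)))

    value≤ : ∀ m → nth π m ≤ suc N
    value≤ = nth-bounded π entry≤

    rc-value : ∀ {m} → m ∈ range1 N → nth (rc π) (c m) ≡ c (nth π m)
    rc-value m∈ = nth-rc (proj₁ (∈-range1⁻ m∈)) (proj₂ (∈-range1⁻ m∈))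

    occurs₁₂₃-rc : ∀ {i j k} → i ∈ range1 N → j ∈ range1 N → k ∈ range1 N →
      occurs (mesh p123 R₂) (rc π) (c k) (c j) (c i) ≡ occurs (mesh p123 R₁) π i j k
    occurs₁₂₃-rc {i} {j} {k} i∈ j∈ k∈ = occurs-rc p123 i∈ j∈ k∈ orderIso≡ sorted
      where
      u = nth π i ; v = nth π j ; w = nth π k
      orderIso≡ : orderIso p123 (rc π) (c k ∷ c j ∷ c i ∷ []) ≡ orderIso p123 π (i ∷ j ∷ k ∷ [])
      orderIso≡ = begin
        orderIso p123 (rc π) (c k ∷ c j ∷ c i ∷ [])  ≡⟨ orderIso-123 (rc π) (c k) (c j) (c i) ⟩
        (nth (rc π) (c k) <ᵇ nth (rc π) (c j)) ∧ (nth (rc π) (c j) <ᵇ nth (rc π) (c i))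
          ≡⟨ cong₂ _∧_ (cong₂ _<ᵇ_ (rc-value k∈) (rc-value j∈)) (cong₂ _<ᵇ_ (rc-value j∈) (rc-value i∈)) ⟩
        (c w <ᵇ c v) ∧ (c v <ᵇ c u)       ≡⟨ cong₂ _∧_ (reflect-<ᵇ {N} (value≤ k) (value≤ j)) (reflect-<ᵇ {N} (value≤ j) (value≤ i)) ⟩
        (v <ᵇ w) ∧ (u <ᵇ v)               ≡⟨ ∧-comm (v <ᵇ w) (u <ᵇ v) ⟩
        (u <ᵇ v) ∧ (v <ᵇ w)               ≡⟨ sym (orderIso-123 π i j k) ⟩
        orderIso p123 π (i ∷ j ∷ k ∷ [])  ∎
        where open ≡-Reasoning
      sorted : orderIso p123 π (i ∷ j ∷ k ∷ []) ≡ true → SortReflected i j k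
      sorted oi = u , v , w , sort-increasing u<v v<w ,
        trans (cong sort (cong₂ _∷_ (rc-value k∈) (cong₂ _∷_ (rc-value j∈) (cong (_∷ []) (rc-value i∈)))))
              (sort-increasing (∸-monoʳ-< v<w (value≤ k)) (∸-monoʳ-< u<v (value≤ j))) ,
        value≤ i All.∷ value≤ j All.∷ value≤ k All.∷ All.[]
        where
        uvw = ∧-true⁻ (trans (sym (orderIso-123 π i j k)) oi)
        u<v = <ᵇ-sound (proj₁ uvw)
        v<w = <ᵇ-sound (proj₂ uvw)

    occurs₃₂₁-rc : ∀ {i j k} → i ∈ range1 N → j ∈ range1 N → k ∈ range1 N →
      occurs (mesh p321 R₂) (rc π) (c k) (c j) (c i) ≡ occurs (mesh p321 R₁) π i j k
    occurs₃₂₁-rc {i} {j} {k} i∈ j∈ k∈ = occurs-rc p321 i∈ j∈ k∈ orderIso≡ sorted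
      where
      u = nth π i ; v = nth π j ; w = nth π k
      orderIso≡ : orderIso p321 (rc π) (c k ∷ c j ∷ c i ∷ []) ≡ orderIso p321 π (i ∷ j ∷ k ∷ [])
      orderIso≡ = begin
        orderIso p321 (rc π) (c k ∷ c j ∷ c i ∷ [])  ≡⟨ orderIso-321 (rc π) (c k) (c j) (c i) ⟩
        (nth (rc π) (c j) <ᵇ nth (rc π) (c k)) ∧ (nth (rc π) (c i) <ᵇ nth (rc π) (c j))
          ≡⟨ cong₂ _∧_ (cong₂ _<ᵇ_ (rc-value j∈) (rc-value k∈)) (cong₂ _<ᵇ_ (rc-value i∈) (rc-value j∈)) ⟩
        (c v <ᵇ c w) ∧ (c u <ᵇ c v)       ≡⟨ cong₂ _∧_ (reflect-<ᵇ {N} (value≤ j) (value≤ k)) (reflect-<ᵇ {N} (value≤ i) (value≤ j)) ⟩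
        (w <ᵇ v) ∧ (v <ᵇ u)               ≡⟨ ∧-comm (w <ᵇ v) (v <ᵇ u) ⟩
        (v <ᵇ u) ∧ (w <ᵇ v)               ≡⟨ sym (orderIso-321 π i j k) ⟩
        orderIso p321 π (i ∷ j ∷ k ∷ [])  ∎
        where open ≡-Reasoning
      sorted : orderIso p321 π (i ∷ j ∷ k ∷ []) ≡ true → SortReflected i j k
      sorted oi = w , v , u , sort-decreasing w<v v<u ,
        trans (cong sort (cong₂ _∷_ (rc-value k∈) (cong₂ _∷_ (rc-value j∈) (cong (_∷ []) (rc-value i∈)))))
              (sort-decreasing (∸-monoʳ-< v<u (value≤ i)) (∸-monoʳ-< w<v (value≤ j))) ,
        value≤ k All.∷ value≤ j All.∷ value≤ i All.∷ All.[]
        where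
        vuw = ∧-true⁻ (trans (sym (orderIso-321 π i j k)) oi)
        v<u = <ᵇ-sound (proj₁ vuw)
        w<v = <ᵇ-sound (proj₂ vuw)

    occ-rc : ∀ {a b d} → (∀ {i j k} → i ∈ range1 N → j ∈ range1 N → k ∈ range1 N →
               occurs (mesh (a ∷ b ∷ d ∷ []) R₂) (rc π) (c k) (c j) (c i) ≡ occurs (mesh (a ∷ b ∷ d ∷ []) R₁) π i j k) →
             occ (mesh (a ∷ b ∷ d ∷ []) R₁) π ≡ occ (mesh (a ∷ b ∷ d ∷ []) R₂) (rc π)
    occ-rc {a} {b} {d} pointwise = begin
      occ (mesh pat R₁) π                                            ≡⟨ occ-∑³ {a} {b} {d} {R₁} π ⟩
      ∑³ (positions π) (λ i j k → ⟦ occurs (mesh pat R₁) π i j k ⟧)  ≡⟨ cong (λ n → ∑³ (range1 n) (λ i j k → ⟦ occurs (mesh pat R₁) π i j k ⟧)) (perm-length P) ⟩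
      ∑³ S (λ i j k → ⟦ occurs (mesh pat R₁) π i j k ⟧)              ≡⟨ ∑-cong S (λ i∈ → ∑-cong S (λ j∈ → ∑-cong S (λ k∈ → cong ⟦_⟧ (sym (pointwise i∈ j∈ k∈))))) ⟩
      ∑³ S (λ i j k → O (c k) (c j) (c i))                           ≡⟨ sym (∑³-reverse S (λ i j k → O (c i) (c j) (c k))) ⟩
      ∑³ S (λ i j k → O (c i) (c j) (c k))                           ≡⟨ sym reflect³ ⟩
      ∑³ S O                                                         ≡⟨ cong (λ n → ∑³ (range1 n) O) (sym len-rc) ⟩
      ∑³ (positions (rc π)) O                                        ≡⟨ sym (occ-∑³ {a} {b} {d} {R₂} (rc π)) ⟩
      occ (mesh pat R₂) (rc π)                                       ∎
      where
      open ≡-Reasoning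
      pat = a ∷ b ∷ d ∷ []
      S = range1 N
      O : ℕ → ℕ → ℕ → ℕ
      O i j k = ⟦ occurs (mesh pat R₂) (rc π) i j k ⟧
      reflect³ : ∑³ S O ≡ ∑³ S (λ i j k → O (c i) (c j) (c k))
      reflect³ = trans (∑-reflect {N} _) (∑-cong S λ {i} _ → trans (∑-reflect {N} _) (∑-cong S λ {j} _ → ∑-reflect {N} _))

  occ₁₂₃-rc : occ (mesh p123 R₁) π ≡ occ (mesh p123 R₂) (rc π)
  occ₁₂₃-rc = occ-rc {1} {2} {3} occurs₁₂₃-rc

  occ₃₂₁-rc : occ (mesh p321 R₁) π ≡ occ (mesh p321 R₂) (rc π)
  occ₃₂₁-rc = occ-rc {3} {2} {1} occurs₃₂₁-rc

rc-exchanger : Exchanger (mesh p123 R₂) (mesh p321 R₂) → Exchanger (mesh p123 R₁) (mesh p321 R₁)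
rc-exchanger E = record
  { exchange   = λ n π → rc (exchange n (rc π))
  ; perm       = λ n P → rc-perm (perm n (rc-perm P))
  ; involutive = λ n {π} P → begin
      rc (exchange n (rc (rc (exchange n (rc π)))))  ≡⟨ cong (rc ∘ exchange n) (rc-involutive (perm n (rc-perm P))) ⟩
      rc (exchange n (exchange n (rc π)))            ≡⟨ cong rc (involutive n (rc-perm P)) ⟩
      rc (rc π)                                      ≡⟨ rc-involutive P ⟩
      π                                              ∎
  ; exchanges  = λ n {π} P → let P′ = perm n (rc-perm P) in
      trans (occ₁₂₃-rc (rc-perm P′)) (trans (cong (occ (mesh p123 R₂)) (rc-involutive P′))
        (trans (proj₁ (exchanges n (rc-perm P))) (sym (occ₃₂₁-rc P)))) ,
      trans (occ₃₂₁-rc (rc-perm P′)) (trans (cong (occ (mesh p321 R₂)) (rc-involutive P′))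
        (trans (proj₂ (exchanges n (rc-perm P))) (sym (occ₁₂₃-rc P))))
  }
  where
  open Exchanger E
  open ≡-Reasoning

theorem2p1 : JointlyEquidistributed (mesh p123 R₁) (mesh p321 R₁)
           × JointlyEquidistributed (mesh p123 R₂) (mesh p321 R₂)
theorem2p1 = exchanger⇒equidistributed (rc-exchanger Φ-exchanger) , exchanger⇒equidistributed Φ-exchanger
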